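{- Let $b>1$ be an integer, $A\subsetneq\{0,\dots,b-1\}$ with $A\neq\{0\}$, $N=\#A$, $f=\max A$, and $\gamma_j=\sum_{a\in A}a^j$ for $j\geq1$. Let $\mathcal{A}$ be the set of admissible non-negative integers (all base-$b$ digits, without leading zeros, lie in $A$; $0$ is admissible iff $0\in A$), and for a non-negative integer $n$ let $l(n)$ be the smallest non-negative integer $l$ with $n<b^l$. Define the measure $\mu$ on $[0,\infty)$ by $$\mu=\sum_{l\geq0}b^{ -l}\sum_{n\in\mathcal{A}}\delta_{n/b^l}\ \text{ if }0\in A,\qquad \mu=\delta_0+\sum_{l\geq0}b^{ -l}\sum_{n\in\mathcal{A},\,l(n)\geq l}\delta_{n/b^l}\ \text{ if }0\notin A,$$ let $u_m=\int_{[0,1)}x^m\,d\mu(x)$, and for $m\geq1$ define $$\lambda_m=m\Big(\frac{b-1}{f}\Big)^{m-1}\frac{u_{m-1}}{u_0}.$$ Then for all $m\geq2$, $$(b^m-N)\,\lambda_m=\sum_{j=1}^{m-1}\binom{m}{j}\frac{\gamma_j}{f^j}(b-1)^j\lambda_{m-j},$$ and $b^{ -1}<\lambda_m<1$ for all $m\geq2$, while $\lambda_1=1$.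
   Context: $\delta_x$ denotes the Dirac point mass at $x$. -}

module Defs where

open import Data.Bool using (Bool; true; false; if_then_else_; _∧_; _∨_; not)
open import Data.Nat as ℕ using (ℕ; zero; suc; _<_; _≤_; _<ᵇ_; NonZero; z<s; s<s)
open import Data.Nat.DivMod using (_mod_)
open import Data.Fin using (Fin; toℕ; fromℕ<)
open import Data.Fin.Subset using (Subset)
open import Data.Vec using (lookup)
open import Data.List using (List; foldr; map; upTo; filter)
open import Data.Product using (∃; _×_)
open import Data.Integer using (+_)
open import Data.Rational as ℚ using (ℚ; 0ℚ; 1ℚ; _+_; _*_; _-_; _÷_; ∣_∣)
open import Relation.Nullary using (yes; no)
open import Relation.Binary.PropositionalEquality using (_≡_)

nz : ∀ {b} → 1 < b → NonZero b
nz (s<s z<s) = _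

zeroFin : ∀ {b} → 1 < b → Fin b
zeroFin {b} hb = fromℕ< (<-trans z<s hb)
  where open import Data.Nat.Properties

ℕ→ℚ : ℕ → ℚ
ℕ→ℚ n = + n ℚ./ 1

-- totalised division on ℚ (x ÷₀ 0 = 0)
_÷₀_ : ℚ → ℚ → ℚ
x ÷₀ y with y ℚ.≟ 0ℚ
... | yes _ = 0ℚ
... | no y≢0 = _÷_ x y {{ℚ.≢-nonZero y≢0}}
  where import Data.Rational.Properties

_^ℚ_ : ℚ → ℕ → ℚ
x ^ℚ zero = 1ℚ
x ^ℚ suc n = x * (x ^ℚ n)

sumℚ : List ℚ → ℚ
sumℚ = foldr _+_ 0ℚ

-- Σ_{j=lo}^{hi-1}: sum over j with lo ≤ j < hi
sumRange : ℕ → ℕ → (ℕ → ℚ) → ℚ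
sumRange lo hi f = sumℚ (map (λ j → if j <ᵇ lo then 0ℚ else f j) (upTo hi))

module Base (b : ℕ) (hb : 1 < b) (A : Subset b) where

  instance
    b≢0 : NonZero b
    b≢0 = nz hb

  inA : Fin b → Bool
  inA d = lookup A d

  -- all base-b digits of n lie in A (fuel argument first; fuel n suffices)
  digitsIn : ℕ → ℕ → Bool
  digitsIn _ zero = true
  digitsIn zero (suc n) = false
  digitsIn (suc k) (suc n) = inA (suc n mod b) ∧ digitsIn k (suc n ℕ./ b)

  admissible : ℕ → Bool
  admissible zero = inA (zeroFin hb)
  admissible (suc n) = digitsIn (suc n) (suc n)

  -- l(n) : smallest l with n < b^l (searched among 0,…,n, which suffices as n < b^n)
  len : ℕ → ℕ
  len n = go (suc n) 0
    where
    go : ℕ → ℕ → ℕ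
    go zero l = l
    go (suc k) l = if n <ᵇ b ℕ.^ l then l else go k (suc l)

  zeroInA : Bool
  zeroInA = inA (zeroFin hb)

  N : ℕ
  N = Data.Fin.Subset.∣ A ∣

  f : ℕ
  f = foldr (λ i acc → if inA i then ℕ._⊔_ (toℕ i) acc else acc) 0 (Data.List.allFin b)

  γ : ℕ → ℚ
  γ j = sumℚ (map (λ i → if inA i then ℕ→ℚ (toℕ i ℕ.^ j) else 0ℚ) (Data.List.allFin b))

  bℚ : ℚ
  bℚ = ℕ→ℚ b

  -- the atoms of μ lying in [0,1) at level l:  n / b^l with n < b^l, n admissible,
  -- and additionally l ≤ l(n) when 0 ∉ A; each with weight b^{-l}
  levelTerm : ℕ → ℕ → ℚ
  levelTerm m l =
    (1ℚ ÷₀ (bℚ ^ℚ l)) *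
    sumℚ (map (λ n → if admissible n ∧ (zeroInA ∨ (l ℕ.≤ᵇ len n))
                       then (ℕ→ℚ n ÷₀ (bℚ ^ℚ l)) ^ℚ m else 0ℚ)
              (upTo (b ℕ.^ l)))

  -- partial sums (levels l < L) of u_m = ∫_{[0,1)} x^m dμ ; the first summand is the
  -- extra δ_0 present when 0 ∉ A (0^0 = 1)
  uPartial : ℕ → ℕ → ℚ
  uPartial m L = (if zeroInA then 0ℚ else (0ℚ ^ℚ m)) + sumRange 0 L (levelTerm m)

  lam : (ℕ → ℚ) → ℕ → ℚ
  lam u zero = 0ℚ
  lam u (suc k) = ℕ→ℚ (suc k) * ((ℕ→ℚ (b ℕ.∸ 1) ÷₀ ℕ→ℚ f) ^ℚ k) * (u k ÷₀ u 0)

  rhs : (ℕ → ℚ) → ℕ → ℚ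
  rhs u m = sumRange 1 m (λ j → ℕ→ℚ (m C j) * (γ j ÷₀ (ℕ→ℚ f ^ℚ j))
                               * (ℕ→ℚ (b ℕ.∸ 1) ^ℚ j) * lam u (m ℕ.∸ j))
    where open import Data.Nat.Combinatorics using (_C_)

ConvergesTo : (ℕ → ℚ) → ℚ → Set
ConvergesTo s q = ∀ (ε : ℚ) → 0ℚ ℚ.< ε → ∃ λ L₀ → ∀ L → L₀ ≤ L → ∣ s L - q ∣ ℚ.< ε

-- On [0,1) the measure μ is self-similar: μ = δ₀ + b⁻¹ Σ_{a ∈ A} (x ↦ (x + a) / b)_* μ, where
-- the δ₀ is the atom 0 of level 0 (present in both cases of the definition). On moments this
-- reads u_m = 0^m + b^{-(m+1)} Σ_j C(m,j) γ_j u_{m-j}, with γ_0 = N. The contributions of the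
-- levels l < L obey the same recursion, so their distance to its solution u shrinks by the
-- factor N / b < 1 with each level, which gives convergence. Moving the term N u_m to the left
-- and substituting λ, the identity (m - j) C(m,j) = m C(m-1,j) yields the recursion for λ_m.
-- With c = (b-1)/f, its coefficients for j = 1, …, m-1 sum to Σ_{a ∈ A} ((ca + 1)^m - (ca)^m) - N;
-- as the points ca are at least c ≥ 1 apart and lie in [0, b-1], the sum telescopes to less
-- than b^m - N, and induction gives λ_m < 1. The lower bound β < λ_m uses the term j = m-1,
-- whose factor λ_1 = 1 is known exactly.

module Submission where

open import Data.Bool using (Bool; true; false; if_then_else_; _∧_; _∨_; T)
import Data.Bool.Properties as Boolₚ
open import Data.Empty using (⊥-elim)
open import Data.Fin as Fin using (Fin; toℕ; fromℕ<)
import Data.Fin.Properties as Finₚ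
open import Data.Fin.Subset using (Subset; ⊤; ⁅_⁆; Nonempty; ∣_∣; _∈_)
import Data.Fin.Subset.Properties as Subsetₚ
open Subsetₚ using (_∈?_)
import Data.Integer as ℤ
import Data.Integer.Properties as ℤₚ
open import Data.List using ([]; _∷_; applyUpTo; map; upTo; allFin; tabulate; foldr)
open import Data.List.Membership.Propositional using () renaming (_∈_ to _∈ₗ_)
open import Data.List.Membership.Propositional.Properties using (∈-allFin)
open import Data.List.Relation.Unary.Any using (here; there)
open import Data.List.Properties using (map-tabulate)
open import Data.Nat as ℕ using (ℕ; zero; suc; z≤n; s≤s; _∸_)
import Data.Nat.Coprimality as Coprime
import Data.Nat.Properties as ℕₚ
import Data.Nat.Solver as ℕ-Solver
open import Data.Nat.DivMod
  using (_/_; _%_; _mod_; m≡m%n+[m/n]*n; m%n<n; m/n*n≤m; m<n⇒m%n≡m; m<n⇒m/n≡0; [m+kn]%n≡m%n;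
         +-distrib-/-∣ʳ; m*n/n≡m; m<n*o⇒m/o<n; 0/n≡0; m≥n⇒m/n>0; m/n<m)
open import Data.Nat.Divisibility using (divides)
open import Data.Nat.Combinatorics using (_C_; nCn≡1; nC1≡n; nCk≡nC[n∸k]; nCk+nC[k+1]≡[n+1]C[k+1])
open import Data.Vec using ([]; _∷_)
import Data.Vec
import Data.Vec.Properties as Vecₚ
open import Data.Product using (Σ; Σ-syntax; _×_; _,_; proj₁; proj₂)
open import Data.Rational using (ℚ; mkℚ; 0ℚ; 1ℚ; _+_; _*_; _-_; -_; _≤_; _<_)
import Data.Rational as ℚ
import Data.Rational.Properties as ℚₚ
open import Data.Rational.Solver using (module +-*-Solver)
open import Data.Nat.Induction using (<-rec)
open import Data.Sum using (_⊎_; inj₁; inj₂)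
open import Function using (_∘_)
open import Relation.Binary.PropositionalEquality
open import Relation.Nullary using (yes; no; ¬_)
open import Relation.Nullary.Decidable using (_→-dec_)
open import Relation.Binary.Definitions using (tri<; tri≈; tri>)
open import Algebra.Bundles using (CommutativeRing)
import Algebra.Properties.CommutativeSemiring.Binomial as Binomial
import Algebra.Properties.CommutativeSemiring.Exp as Exp
import Algebra.Properties.Semiring.Mult as Mult
import Algebra.Properties.Semiring.Sum as Sum
open import Defs

-- Binomial coefficients

[k+1]*[n+1]C[k+1]≡[n+1]*nCk : ∀ n k → suc k ℕ.* (suc n C suc k) ≡ suc n ℕ.* (n C k)
[k+1]*[n+1]C[k+1]≡[n+1]*nCk n zero =
  trans (ℕₚ.+-identityʳ _) (trans (nC1≡n (suc n)) (sym (ℕₚ.*-identityʳ (suc n))))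
[k+1]*[n+1]C[k+1]≡[n+1]*nCk zero (suc k) = ℕₚ.*-zeroʳ (suc (suc k))
[k+1]*[n+1]C[k+1]≡[n+1]*nCk (suc n) (suc k) = begin
  suc (suc k) ℕ.* (suc (suc n) C suc (suc k))
    ≡⟨ cong (suc (suc k) ℕ.*_) (sym (nCk+nC[k+1]≡[n+1]C[k+1] (suc n) (suc k))) ⟩
  suc (suc k) ℕ.* (a ℕ.+ c)
    ≡⟨ solve 3 (λ k a c → (con 2 :+ k) :* (a :+ c) := (con 1 :+ k) :* a :+ a :+ (con 2 :+ k) :* c) refl k a c ⟩
  suc k ℕ.* a ℕ.+ a ℕ.+ suc (suc k) ℕ.* c
    ≡⟨ cong₂ (λ s t → s ℕ.+ a ℕ.+ t) ([k+1]*[n+1]C[k+1]≡[n+1]*nCk n k) ([k+1]*[n+1]C[k+1]≡[n+1]*nCk n (suc k)) ⟩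
  suc n ℕ.* d ℕ.+ a ℕ.+ suc n ℕ.* e
    ≡⟨ solve 4 (λ n d e a → (con 1 :+ n) :* d :+ a :+ (con 1 :+ n) :* e := (con 1 :+ n) :* (d :+ e) :+ a) refl n d e a ⟩
  suc n ℕ.* (d ℕ.+ e) ℕ.+ a
    ≡⟨ cong (λ t → suc n ℕ.* t ℕ.+ a) (nCk+nC[k+1]≡[n+1]C[k+1] n k) ⟩
  suc n ℕ.* a ℕ.+ a
    ≡⟨ solve 2 (λ n a → (con 1 :+ n) :* a :+ a := (con 2 :+ n) :* a) refl n a ⟩
  suc (suc n) ℕ.* a
    ∎
  where
  open ≡-Reasoning
  open ℕ-Solver.+-*-Solver
  a : ℕ
  a = suc n C suc k
  c : ℕ
  c = suc n C suc (suc k)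
  d : ℕ
  d = n C k
  e : ℕ
  e = n C suc k

[1+m∸j]*[1+m]Cj≡[1+m]*mCj : ∀ {m j} → j ℕ.≤ m → (suc m ∸ j) ℕ.* (suc m C j) ≡ suc m ℕ.* (m C j)
[1+m∸j]*[1+m]Cj≡[1+m]*mCj {m} {j} j≤m = begin
  (suc m ∸ j) ℕ.* (suc m C j)               ≡⟨ cong₂ ℕ._*_ (ℕₚ.+-∸-assoc 1 j≤m) (nCk≡nC[n∸k] (ℕₚ.m≤n⇒m≤1+n j≤m)) ⟩
  suc (m ∸ j) ℕ.* (suc m C (suc m ∸ j))     ≡⟨ cong (λ t → suc (m ∸ j) ℕ.* (suc m C t)) (ℕₚ.+-∸-assoc 1 j≤m) ⟩
  suc (m ∸ j) ℕ.* (suc m C suc (m ∸ j))     ≡⟨ [k+1]*[n+1]C[k+1]≡[n+1]*nCk m (m ∸ j) ⟩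
  suc m ℕ.* (m C (m ∸ j))                   ≡⟨ cong (suc m ℕ.*_) (sym (nCk≡nC[n∸k] j≤m)) ⟩
  suc m ℕ.* (m C j)                         ∎
  where open ≡-Reasoning

open +-*-Solver using (solve; _:+_; _:*_; _:=_; :-_; con)

private
  variable
    p q r x y : ℚ

ℕ→ℚ≡mkℚ : ∀ n → ℕ→ℚ n ≡ mkℚ (ℤ.+ n) 0 (Coprime.sym (Coprime.1-coprimeTo n))
ℕ→ℚ≡mkℚ n = ℚₚ.normalize-coprime (Coprime.sym (Coprime.1-coprimeTo n))

ℕ→ℚ-homo-+ : ∀ m n → ℕ→ℚ (m ℕ.+ n) ≡ ℕ→ℚ m + ℕ→ℚ n
ℕ→ℚ-homo-+ m n rewrite ℕ→ℚ≡mkℚ m | ℕ→ℚ≡mkℚ n =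
  ℚₚ./-cong (cong₂ ℤ._+_ (sym (ℤₚ.*-identityʳ (ℤ.+ m))) (sym (ℤₚ.*-identityʳ (ℤ.+ n)))) refl

ℕ→ℚ-homo-* : ∀ m n → ℕ→ℚ (m ℕ.* n) ≡ ℕ→ℚ m * ℕ→ℚ n
ℕ→ℚ-homo-* m n rewrite ℕ→ℚ≡mkℚ m | ℕ→ℚ≡mkℚ n = ℚₚ./-cong (ℤₚ.pos-* m n) refl

ℕ→ℚ-suc : ∀ n → ℕ→ℚ (suc n) ≡ 1ℚ + ℕ→ℚ n
ℕ→ℚ-suc = ℕ→ℚ-homo-+ 1

x+y≡z⇒x≡z-y : x + y ≡ r → x ≡ r - y
x+y≡z⇒x≡z-y {x} {y} refl = solve 2 (λ x y → x := (x :+ y) :+ (:- y)) refl x y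

ℕ→ℚ-homo-∸ : ∀ {m n} → n ℕ.≤ m → ℕ→ℚ (m ∸ n) ≡ ℕ→ℚ m - ℕ→ℚ n
ℕ→ℚ-homo-∸ {m} {n} n≤m =
  x+y≡z⇒x≡z-y (trans (sym (ℕ→ℚ-homo-+ (m ∸ n) n)) (cong ℕ→ℚ (ℕₚ.m∸n+n≡m n≤m)))

ℕ→ℚ-mono-≤ : ∀ {m n} → m ℕ.≤ n → ℕ→ℚ m ≤ ℕ→ℚ n
ℕ→ℚ-mono-≤ {m} {n} m≤n rewrite ℕ→ℚ≡mkℚ m | ℕ→ℚ≡mkℚ n =
  ℚ.*≤* (subst₂ ℤ._≤_ (sym (ℤₚ.*-identityʳ (ℤ.+ m))) (sym (ℤₚ.*-identityʳ (ℤ.+ n))) (ℤ.+≤+ m≤n))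

ℕ→ℚ-mono-< : ∀ {m n} → m ℕ.< n → ℕ→ℚ m < ℕ→ℚ n
ℕ→ℚ-mono-< {m} {n} m<n rewrite ℕ→ℚ≡mkℚ m | ℕ→ℚ≡mkℚ n =
  ℚ.*<* (subst₂ ℤ._<_ (sym (ℤₚ.*-identityʳ (ℤ.+ m))) (sym (ℤₚ.*-identityʳ (ℤ.+ n))) (ℤ.+<+ m<n))

ℕ→ℚ-nonNeg : ∀ n → 0ℚ ≤ ℕ→ℚ n
ℕ→ℚ-nonNeg n = ℕ→ℚ-mono-≤ {0} {n} z≤n

0<1 : 0ℚ < 1ℚ
0<1 = ℕ→ℚ-mono-< {0} {1} (s≤s z≤n)

0≤1 : 0ℚ ≤ 1ℚ
0≤1 = ℚₚ.<⇒≤ 0<1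

archimedean : ∀ q → Σ[ n ∈ ℕ ] q < ℕ→ℚ n
archimedean (mkℚ (ℤ.+ n) d c) = suc n , subst (mkℚ (ℤ.+ n) d c <_) (sym (ℕ→ℚ≡mkℚ (suc n)))
  (ℚ.*<* (subst₂ ℤ._<_ (sym (ℤₚ.*-identityʳ (ℤ.+ n))) (ℤₚ.pos-* (suc n) (suc d))
     (ℤ.+<+ (ℕₚ.<-≤-trans (ℕₚ.n<1+n n) (ℕₚ.m≤m*n (suc n) (suc d))))))
archimedean (mkℚ ℤ.-[1+ n ] d c) = 1 , subst (mkℚ ℤ.-[1+ n ] d c <_) (sym (ℕ→ℚ≡mkℚ 1))
  (ℚ.*<* (subst₂ ℤ._<_ (sym (ℤₚ.*-identityʳ ℤ.-[1+ n ])) (ℤₚ.pos-* 1 (suc d)) ℤ.-<+))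

-- Unlike their namesakes in Data.Rational.Properties, these take the sign condition as an
-- argument rather than as an instance.
*-monoʳ-≤-nonNeg : 0ℚ ≤ r → p ≤ q → p * r ≤ q * r
*-monoʳ-≤-nonNeg {r} 0≤r = ℚₚ.*-monoʳ-≤-nonNeg r {{ℚ.nonNegative 0≤r}}

*-monoˡ-≤-nonNeg : 0ℚ ≤ r → p ≤ q → r * p ≤ r * q
*-monoˡ-≤-nonNeg {r} 0≤r = ℚₚ.*-monoˡ-≤-nonNeg r {{ℚ.nonNegative 0≤r}}

*-monoˡ-<-pos : 0ℚ < r → p < q → p * r < q * r
*-monoˡ-<-pos {r} 0<r = ℚₚ.*-monoˡ-<-pos r {{ℚ.positive 0<r}}

*-monoʳ-<-pos : 0ℚ < r → p < q → r * p < r * q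
*-monoʳ-<-pos {r} 0<r = ℚₚ.*-monoʳ-<-pos r {{ℚ.positive 0<r}}

*-cancelʳ-≤-pos : 0ℚ < r → p * r ≤ q * r → p ≤ q
*-cancelʳ-≤-pos {r} 0<r = ℚₚ.*-cancelʳ-≤-pos r {{ℚ.positive 0<r}}

*-cancelʳ-<-nonNeg : 0ℚ ≤ r → p * r < q * r → p < q
*-cancelʳ-<-nonNeg {r} 0≤r = ℚₚ.*-cancelʳ-<-nonNeg r {{ℚ.nonNegative 0≤r}}

nonNeg*nonNeg⇒nonNeg : 0ℚ ≤ p → 0ℚ ≤ q → 0ℚ ≤ p * q
nonNeg*nonNeg⇒nonNeg {p} {q} 0≤p 0≤q = subst (_≤ p * q) (ℚₚ.*-zeroˡ q) (*-monoʳ-≤-nonNeg 0≤q 0≤p)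

pos*pos⇒pos : 0ℚ < p → 0ℚ < q → 0ℚ < p * q
pos*pos⇒pos {p} {q} 0<p 0<q = subst (_< p * q) (ℚₚ.*-zeroˡ q) (*-monoˡ-<-pos 0<q 0<p)

nonNeg+nonNeg⇒nonNeg : 0ℚ ≤ p → 0ℚ ≤ q → 0ℚ ≤ p + q
nonNeg+nonNeg⇒nonNeg = ℚₚ.+-mono-≤

p≤p+q : 0ℚ ≤ q → p ≤ p + q
p≤p+q {q = q} {p = p} 0≤q = subst (_≤ p + q) (ℚₚ.+-identityʳ p) (ℚₚ.+-monoʳ-≤ p 0≤q)

p≤q⇒0≤q-p : p ≤ q → 0ℚ ≤ q - p
p≤q⇒0≤q-p {p} {q} p≤q = subst (_≤ q - p) (ℚₚ.+-inverseʳ p) (ℚₚ.+-monoˡ-≤ (- p) p≤q)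

p<q⇒0<q-p : p < q → 0ℚ < q - p
p<q⇒0<q-p {p} {q} p<q = subst (_< q - p) (ℚₚ.+-inverseʳ p) (ℚₚ.+-monoˡ-< (- p) p<q)

p≤q⇒p+[r-q]≤r : p ≤ q → p + (r - q) ≤ r
p≤q⇒p+[r-q]≤r {p} {q} {r} p≤q = subst (p + (r - q) ≤_) (solve 2 (λ r q → q :+ (r :+ (:- q)) := r) refl r q)
  (ℚₚ.+-monoˡ-≤ (r - q) p≤q)

p<q⇒p+[r-q]<r : p < q → p + (r - q) < r
p<q⇒p+[r-q]<r {p} {q} {r} p<q = subst (p + (r - q) <_) (solve 2 (λ r q → q :+ (r :+ (:- q)) := r) refl r q)
  (ℚₚ.+-monoˡ-< (r - q) p<q)

private
  module ℚ-Exp = Exp (CommutativeRing.commutativeSemiring ℚₚ.+-*-commutativeRing)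
  module ℚ-Binomial = Binomial (CommutativeRing.commutativeSemiring ℚₚ.+-*-commutativeRing)
  module ℚ-Sum = Sum (CommutativeRing.semiring ℚₚ.+-*-commutativeRing)
  module ℚ-Mult = Mult (CommutativeRing.semiring ℚₚ.+-*-commutativeRing)

^ℚ≡^ : ∀ x n → x ^ℚ n ≡ x ℚ-Exp.^ n
^ℚ≡^ x zero = refl
^ℚ≡^ x (suc n) = cong (x *_) (^ℚ≡^ x n)

^ℚ-homo-* : ∀ x m n → x ^ℚ (m ℕ.+ n) ≡ x ^ℚ m * x ^ℚ n
^ℚ-homo-* x m n = begin
  x ^ℚ (m ℕ.+ n)             ≡⟨ ^ℚ≡^ x (m ℕ.+ n) ⟩
  x ℚ-Exp.^ (m ℕ.+ n)        ≡⟨ ℚ-Exp.^-homo-* x m n ⟩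
  x ℚ-Exp.^ m * x ℚ-Exp.^ n  ≡⟨ sym (cong₂ _*_ (^ℚ≡^ x m) (^ℚ≡^ x n)) ⟩
  x ^ℚ m * x ^ℚ n            ∎
  where open ≡-Reasoning

^ℚ-distrib-* : ∀ x y n → (x * y) ^ℚ n ≡ x ^ℚ n * y ^ℚ n
^ℚ-distrib-* x y n = begin
  (x * y) ^ℚ n               ≡⟨ ^ℚ≡^ (x * y) n ⟩
  (x * y) ℚ-Exp.^ n          ≡⟨ ℚ-Exp.^-distrib-* x y n ⟩
  x ℚ-Exp.^ n * y ℚ-Exp.^ n  ≡⟨ sym (cong₂ _*_ (^ℚ≡^ x n) (^ℚ≡^ y n)) ⟩
  x ^ℚ n * y ^ℚ n            ∎
  where open ≡-Reasoning

1^ℚn≡1 : ∀ n → 1ℚ ^ℚ n ≡ 1ℚ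
1^ℚn≡1 zero = refl
1^ℚn≡1 (suc n) = trans (ℚₚ.*-identityˡ _) (1^ℚn≡1 n)

0^ℚ[1+n]≡0 : ∀ n → 0ℚ ^ℚ suc n ≡ 0ℚ
0^ℚ[1+n]≡0 n = ℚₚ.*-zeroˡ (0ℚ ^ℚ n)

ℕ→ℚ-homo-^ : ∀ m n → ℕ→ℚ (m ℕ.^ n) ≡ ℕ→ℚ m ^ℚ n
ℕ→ℚ-homo-^ m zero = refl
ℕ→ℚ-homo-^ m (suc n) = trans (ℕ→ℚ-homo-* m (m ℕ.^ n)) (cong (ℕ→ℚ m *_) (ℕ→ℚ-homo-^ m n))

^ℚ-nonNeg : ∀ n → 0ℚ ≤ x → 0ℚ ≤ x ^ℚ n
^ℚ-nonNeg zero 0≤x = 0≤1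
^ℚ-nonNeg (suc n) 0≤x = nonNeg*nonNeg⇒nonNeg 0≤x (^ℚ-nonNeg n 0≤x)

^ℚ-mono-≤ : ∀ n → 0ℚ ≤ x → x ≤ y → x ^ℚ n ≤ y ^ℚ n
^ℚ-mono-≤ zero 0≤x x≤y = ℚₚ.≤-refl
^ℚ-mono-≤ (suc n) 0≤x x≤y = ℚₚ.≤-trans (*-monoʳ-≤-nonNeg (^ℚ-nonNeg n 0≤x) x≤y)
  (*-monoˡ-≤-nonNeg (ℚₚ.≤-trans 0≤x x≤y) (^ℚ-mono-≤ n 0≤x x≤y))

^ℚ-mono-< : ∀ n → 0ℚ ≤ x → x < y → x ^ℚ suc n < y ^ℚ suc n
^ℚ-mono-< {x} {y} zero 0≤x x<y = subst₂ _<_ (sym (ℚₚ.*-identityʳ x)) (sym (ℚₚ.*-identityʳ y)) x<y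
^ℚ-mono-< (suc n) 0≤x x<y = ℚₚ.≤-<-trans (*-monoʳ-≤-nonNeg (^ℚ-nonNeg (suc n) 0≤x) (ℚₚ.<⇒≤ x<y))
  (*-monoʳ-<-pos (ℚₚ.≤-<-trans 0≤x x<y) (^ℚ-mono-< n 0≤x x<y))

^ℚ-≤1 : ∀ n → 0ℚ ≤ x → x ≤ 1ℚ → x ^ℚ n ≤ 1ℚ
^ℚ-≤1 {x} n 0≤x x≤1 = subst (x ^ℚ n ≤_) (1^ℚn≡1 n) (^ℚ-mono-≤ n 0≤x x≤1)

1≤^ℚ : ∀ n → 1ℚ ≤ x → 1ℚ ≤ x ^ℚ n
1≤^ℚ {x} n 1≤x = subst (_≤ x ^ℚ n) (1^ℚn≡1 n) (^ℚ-mono-≤ n 0≤1 1≤x)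

infix 30 _⁻¹

_⁻¹ : ℚ → ℚ
x ⁻¹ = 1ℚ ÷₀ x

x÷₀y≡x*y⁻¹ : ∀ x y → x ÷₀ y ≡ x * y ⁻¹
x÷₀y≡x*y⁻¹ x y with y ℚ.≟ 0ℚ
... | yes _ = sym (ℚₚ.*-zeroʳ x)
... | no _ = cong (x *_) (sym (ℚₚ.*-identityˡ _))

⁻¹-inverseʳ : x ≢ 0ℚ → x * x ⁻¹ ≡ 1ℚ
⁻¹-inverseʳ {x} x≢0 with x ℚ.≟ 0ℚ
... | yes x≡0 = ⊥-elim (x≢0 x≡0)
... | no x≢0 = trans (cong (x *_) (ℚₚ.*-identityˡ _)) (ℚₚ.*-inverseʳ x {{ℚ.≢-nonZero x≢0}})

⁻¹-inverseˡ : x ≢ 0ℚ → x ⁻¹ * x ≡ 1ℚ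
⁻¹-inverseˡ {x} x≢0 = trans (ℚₚ.*-comm (x ⁻¹) x) (⁻¹-inverseʳ x≢0)

⁻¹-pos : 0ℚ < x → 0ℚ < x ⁻¹
⁻¹-pos {x} 0<x with x ℚ.≟ 0ℚ
... | yes x≡0 = ⊥-elim (ℚₚ.<⇒≢ 0<x (sym x≡0))
... | no x≢0 = subst (0ℚ <_) (sym (ℚₚ.*-identityˡ 1/x))
  (ℚₚ.positive⁻¹ 1/x {{ℚₚ.1/pos⇒pos x {{ℚ.positive 0<x}}}})
  where 1/x = (ℚ.1/ x) {{ℚ.≢-nonZero x≢0}}

⁻¹-unique : x * y ≡ 1ℚ → y ≡ x ⁻¹
⁻¹-unique {x} {y} xy≡1 = begin
  y                ≡⟨ sym (ℚₚ.*-identityˡ y) ⟩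
  1ℚ * y           ≡⟨ cong (_* y) (sym (⁻¹-inverseˡ x≢0)) ⟩
  x ⁻¹ * x * y     ≡⟨ ℚₚ.*-assoc (x ⁻¹) x y ⟩
  x ⁻¹ * (x * y)   ≡⟨ cong (x ⁻¹ *_) xy≡1 ⟩
  x ⁻¹ * 1ℚ        ≡⟨ ℚₚ.*-identityʳ _ ⟩
  x ⁻¹             ∎
  where
  open ≡-Reasoning
  x≢0 : x ≢ 0ℚ
  x≢0 refl = ℚₚ.1≢0 (trans (sym xy≡1) (ℚₚ.*-zeroˡ y))

⁻¹-distrib-^ℚ : x ≢ 0ℚ → ∀ n → (x ^ℚ n) ⁻¹ ≡ x ⁻¹ ^ℚ n
⁻¹-distrib-^ℚ {x} x≢0 n = sym (⁻¹-unique {x ^ℚ n} (begin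
  x ^ℚ n * x ⁻¹ ^ℚ n    ≡⟨ sym (^ℚ-distrib-* x (x ⁻¹) n) ⟩
  (x * x ⁻¹) ^ℚ n       ≡⟨ cong (_^ℚ n) (⁻¹-inverseʳ x≢0) ⟩
  1ℚ ^ℚ n               ≡⟨ 1^ℚn≡1 n ⟩
  1ℚ                    ∎))
  where open ≡-Reasoning

x^n*[1+n[1-x]]≤1 : ∀ n → 0ℚ ≤ x → x ≤ 1ℚ → x ^ℚ n * (1ℚ + ℕ→ℚ n * (1ℚ - x)) ≤ 1ℚ
x^n*[1+n[1-x]]≤1 {x} zero 0≤x x≤1 =
  ℚₚ.≤-reflexive (solve 1 (λ x → con 1ℚ :* (con 1ℚ :+ con 0ℚ :* (con 1ℚ :+ (:- x))) := con 1ℚ) refl x)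
x^n*[1+n[1-x]]≤1 {x} (suc n) 0≤x x≤1 = begin
  x * x ^ℚ n * (1ℚ + ℕ→ℚ (suc n) * (1ℚ - x))
    ≡⟨ cong (λ t → x * x ^ℚ n * (1ℚ + t * (1ℚ - x))) (ℕ→ℚ-suc n) ⟩
  x * x ^ℚ n * (1ℚ + (1ℚ + ℕ→ℚ n) * (1ℚ - x))
    ≡⟨ solve 3 (λ x p k → x :* p :* (con 1ℚ :+ (con 1ℚ :+ k) :* (con 1ℚ :+ (:- x))) :=
                          x :* (p :* (con 1ℚ :+ k :* (con 1ℚ :+ (:- x)))) :+ x :* p :* (con 1ℚ :+ (:- x)))
         refl x (x ^ℚ n) (ℕ→ℚ n) ⟩
  x * (x ^ℚ n * (1ℚ + ℕ→ℚ n * (1ℚ - x))) + x ^ℚ suc n * (1ℚ - x)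
    ≤⟨ ℚₚ.+-mono-≤ (*-monoˡ-≤-nonNeg 0≤x (x^n*[1+n[1-x]]≤1 n 0≤x x≤1))
                   (*-monoʳ-≤-nonNeg (p≤q⇒0≤q-p x≤1) (^ℚ-≤1 (suc n) 0≤x x≤1)) ⟩
  x * 1ℚ + 1ℚ * (1ℚ - x)
    ≡⟨ solve 1 (λ x → x :* con 1ℚ :+ con 1ℚ :* (con 1ℚ :+ (:- x)) := con 1ℚ) refl x ⟩
  1ℚ
    ∎
  where open ℚₚ.≤-Reasoning

x^n*r→0 : 0ℚ ≤ x → x < 1ℚ → 0ℚ ≤ r → ∀ ε → 0ℚ < ε → Σ[ n₀ ∈ ℕ ] (∀ n → n₀ ℕ.≤ n → x ^ℚ n * r < ε)
x^n*r→0 {x} {r} 0≤x x<1 0≤r ε 0<ε = n₀ , x^n*r<ε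
  where
  δ : ℚ
  δ = 1ℚ - x
  0<δ : 0ℚ < δ
  0<δ = p<q⇒0<q-p x<1
  0<δε : 0ℚ < δ * ε
  0<δε = pos*pos⇒pos 0<δ 0<ε
  n₀ : ℕ
  n₀ = proj₁ (archimedean (r * (δ * ε) ⁻¹))
  x^n*r<ε : ∀ n → n₀ ℕ.≤ n → x ^ℚ n * r < ε
  x^n*r<ε n n₀≤n = *-cancelʳ-<-nonNeg (ℚₚ.<⇒≤ 0<z) (ℚₚ.≤-<-trans x^n*r*z≤r r<ε*z)
    where
    z : ℚ
    z = 1ℚ + ℕ→ℚ n * δ
    0<z : 0ℚ < z
    0<z = ℚₚ.<-≤-trans 0<1 (p≤p+q (nonNeg*nonNeg⇒nonNeg (ℕ→ℚ-nonNeg n) (ℚₚ.<⇒≤ 0<δ)))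
    x^n*r*z≤r : x ^ℚ n * r * z ≤ r
    x^n*r*z≤r = subst₂ _≤_ (solve 3 (λ r p z → r :* (p :* z) := p :* r :* z) refl r (x ^ℚ n) z) (ℚₚ.*-identityʳ r)
      (*-monoˡ-≤-nonNeg 0≤r (x^n*[1+n[1-x]]≤1 n 0≤x (ℚₚ.<⇒≤ x<1)))
    r<ε*z : r < ε * z
    r<ε*z = begin-strict
      r                              ≡⟨ sym (trans (ℚₚ.*-assoc r _ (δ * ε)) (trans (cong (r *_) (⁻¹-inverseˡ (ℚₚ.<⇒≢ 0<δε ∘ sym))) (ℚₚ.*-identityʳ r))) ⟩
      r * (δ * ε) ⁻¹ * (δ * ε)       <⟨ *-monoˡ-<-pos 0<δε (proj₂ (archimedean (r * (δ * ε) ⁻¹))) ⟩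
      ℕ→ℚ n₀ * (δ * ε)               ≤⟨ *-monoʳ-≤-nonNeg (ℚₚ.<⇒≤ 0<δε) (ℕ→ℚ-mono-≤ n₀≤n) ⟩
      ℕ→ℚ n * (δ * ε)                ≤⟨ p≤p+q (ℚₚ.<⇒≤ 0<ε) ⟩
      ℕ→ℚ n * (δ * ε) + ε            ≡⟨ solve 3 (λ n d e → n :* (d :* e) :+ e := e :* (con 1ℚ :+ n :* d)) refl (ℕ→ℚ n) δ ε ⟩
      ε * z                          ∎
      where open ℚₚ.≤-Reasoning

-- Finite sums

map-applyUpTo : ∀ {A B : Set} (h : A → B) (g : ℕ → A) n → map h (applyUpTo g n) ≡ applyUpTo (h ∘ g) n
map-applyUpTo h g zero = refl
map-applyUpTo h g (suc n) = cong (h (g 0) ∷_) (map-applyUpTo h (g ∘ suc) n)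

∑ : ℕ → (ℕ → ℚ) → ℚ
∑ n g = sumℚ (applyUpTo g n)

sumℚ-map-upTo : ∀ n g → sumℚ (map g (upTo n)) ≡ ∑ n g
sumℚ-map-upTo n g = cong sumℚ (map-applyUpTo g (λ i → i) n)

sumℚ-map-allFin : ∀ n (h : Fin n → ℚ) (g : ℕ → ℚ) → (∀ i → h i ≡ g (toℕ i)) →
                  sumℚ (map h (allFin n)) ≡ ∑ n g
sumℚ-map-allFin n h g h≗g = trans (cong sumℚ (map-tabulate (λ i → i) h)) (sumℚ-tabulate n h g h≗g)
  where
  sumℚ-tabulate : ∀ n (h : Fin n → ℚ) (g : ℕ → ℚ) → (∀ i → h i ≡ g (toℕ i)) → sumℚ (tabulate h) ≡ ∑ n g
  sumℚ-tabulate zero h g h≗g = refl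
  sumℚ-tabulate (suc n) h g h≗g =
    cong₂ _+_ (h≗g Fin.zero) (sumℚ-tabulate n (h ∘ Fin.suc) (g ∘ suc) (h≗g ∘ Fin.suc))

∑≡sum : ∀ n g → ∑ n g ≡ ℚ-Sum.sum (λ (i : Fin n) → g (toℕ i))
∑≡sum zero g = refl
∑≡sum (suc n) g = cong (g 0 +_) (∑≡sum n (g ∘ suc))

∑-cong : ∀ n {g h} → (∀ i → i ℕ.< n → g i ≡ h i) → ∑ n g ≡ ∑ n h
∑-cong zero g≗h = refl
∑-cong (suc n) g≗h = cong₂ _+_ (g≗h 0 (s≤s z≤n)) (∑-cong n (λ i i<n → g≗h (suc i) (s≤s i<n)))

∑-zero : ∀ n → ∑ n (λ _ → 0ℚ) ≡ 0ℚ
∑-zero zero = refl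
∑-zero (suc n) = trans (ℚₚ.+-identityˡ _) (∑-zero n)

∑-distrib-+ : ∀ n g h → ∑ n (λ i → g i + h i) ≡ ∑ n g + ∑ n h
∑-distrib-+ zero g h = refl
∑-distrib-+ (suc n) g h rewrite ∑-distrib-+ n (g ∘ suc) (h ∘ suc) =
  solve 4 (λ a b c d → (a :+ b) :+ (c :+ d) := (a :+ c) :+ (b :+ d)) refl
    (g 0) (h 0) (∑ n (g ∘ suc)) (∑ n (h ∘ suc))

∑-distrib-- : ∀ n g h → ∑ n (λ i → g i - h i) ≡ ∑ n g - ∑ n h
∑-distrib-- zero g h = refl
∑-distrib-- (suc n) g h rewrite ∑-distrib-- n (g ∘ suc) (h ∘ suc) =
  solve 4 (λ a b c d → (a :+ (:- b)) :+ (c :+ (:- d)) := (a :+ c) :+ (:- (b :+ d))) refl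
    (g 0) (h 0) (∑ n (g ∘ suc)) (∑ n (h ∘ suc))

*-distribˡ-∑ : ∀ n c g → c * ∑ n g ≡ ∑ n (λ i → c * g i)
*-distribˡ-∑ zero c g = ℚₚ.*-zeroʳ c
*-distribˡ-∑ (suc n) c g =
  trans (ℚₚ.*-distribˡ-+ c (g 0) _) (cong (c * g 0 +_) (*-distribˡ-∑ n c (g ∘ suc)))

*-distribʳ-∑ : ∀ n c g → ∑ n g * c ≡ ∑ n (λ i → g i * c)
*-distribʳ-∑ n c g = trans (ℚₚ.*-comm _ c)
  (trans (*-distribˡ-∑ n c g) (∑-cong n (λ i _ → ℚₚ.*-comm c (g i))))

∑-init-last : ∀ n g → ∑ (suc n) g ≡ ∑ n g + g n
∑-init-last zero g = trans (ℚₚ.+-identityʳ (g 0)) (sym (ℚₚ.+-identityˡ (g 0)))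
∑-init-last (suc n) g =
  trans (cong (g 0 +_) (∑-init-last n (g ∘ suc))) (sym (ℚₚ.+-assoc (g 0) _ _))

∑-split : ∀ m n g → ∑ (m ℕ.+ n) g ≡ ∑ m g + ∑ n (λ i → g (m ℕ.+ i))
∑-split zero n g = sym (ℚₚ.+-identityˡ _)
∑-split (suc m) n g =
  trans (cong (g 0 +_) (∑-split m n (g ∘ suc))) (sym (ℚₚ.+-assoc (g 0) _ _))

∑-double : ∀ m n g → ∑ (m ℕ.* n) g ≡ ∑ m (λ d → ∑ n (λ i → g (d ℕ.* n ℕ.+ i)))
∑-double zero n g = refl
∑-double (suc m) n g = begin
  ∑ (n ℕ.+ m ℕ.* n) g
    ≡⟨ ∑-split n (m ℕ.* n) g ⟩
  ∑ n g + ∑ (m ℕ.* n) (λ i → g (n ℕ.+ i))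
    ≡⟨ cong (∑ n g +_) (∑-double m n (λ i → g (n ℕ.+ i))) ⟩
  ∑ n g + ∑ m (λ d → ∑ n (λ i → g (n ℕ.+ (d ℕ.* n ℕ.+ i))))
    ≡⟨ cong (∑ n g +_) (∑-cong m (λ d _ → ∑-cong n (λ i _ → cong g (sym (ℕₚ.+-assoc n (d ℕ.* n) i))))) ⟩
  ∑ n g + ∑ m (λ d → ∑ n (λ i → g (suc d ℕ.* n ℕ.+ i)))
    ∎
  where open ≡-Reasoning

∑-comm : ∀ m n (h : ℕ → ℕ → ℚ) → ∑ m (λ i → ∑ n (h i)) ≡ ∑ n (λ j → ∑ m (λ i → h i j))
∑-comm zero n h = sym (∑-zero n)
∑-comm (suc m) n h =
  trans (cong (∑ n (h 0) +_) (∑-comm m n (h ∘ suc))) (sym (∑-distrib-+ n (h 0) _))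

∑-mono-≤ : ∀ n {g h} → (∀ i → i ℕ.< n → g i ≤ h i) → ∑ n g ≤ ∑ n h
∑-mono-≤ zero g≤h = ℚₚ.≤-refl
∑-mono-≤ (suc n) g≤h = ℚₚ.+-mono-≤ (g≤h 0 (s≤s z≤n)) (∑-mono-≤ n (λ i i<n → g≤h (suc i) (s≤s i<n)))

∑-nonNeg : ∀ n {g} → (∀ i → i ℕ.< n → 0ℚ ≤ g i) → 0ℚ ≤ ∑ n g
∑-nonNeg n {g} 0≤g = subst (_≤ ∑ n g) (∑-zero n) (∑-mono-≤ n 0≤g)

term≤∑ : ∀ n {g} i → (∀ j → j ℕ.< n → 0ℚ ≤ g j) → i ℕ.< n → g i ≤ ∑ n g
term≤∑ (suc n) {g} zero 0≤g _ =
  subst (_≤ ∑ (suc n) g) (ℚₚ.+-identityʳ (g 0))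
    (ℚₚ.+-monoʳ-≤ (g 0) (∑-nonNeg n (λ j j<n → 0≤g (suc j) (s≤s j<n))))
term≤∑ (suc n) {g} (suc i) 0≤g (s≤s i<n) =
  subst (_≤ ∑ (suc n) g) (ℚₚ.+-identityˡ (g (suc i)))
    (ℚₚ.+-mono-≤ (0≤g 0 (s≤s z≤n)) (term≤∑ n i (λ j j<n → 0≤g (suc j) (s≤s j<n)) i<n))

binomial-theorem : ∀ x y n → (x + y) ^ℚ n ≡ ∑ (suc n) (λ k → ℕ→ℚ (n C k) * (x ^ℚ k * y ^ℚ (n ∸ k)))
binomial-theorem x y n = begin
  (x + y) ^ℚ n
    ≡⟨ ^ℚ≡^ (x + y) n ⟩
  (x + y) ℚ-Exp.^ n
    ≡⟨ ℚ-Binomial.theorem n x y ⟩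
  ℚ-Binomial.binomialExpansion x y n
    ≡⟨ sym (∑≡sum (suc n) (λ k → (n C k) ℚ-Mult.× (x ℚ-Exp.^ k * y ℚ-Exp.^ (n ∸ k)))) ⟩
  ∑ (suc n) (λ k → (n C k) ℚ-Mult.× (x ℚ-Exp.^ k * y ℚ-Exp.^ (n ∸ k)))
    ≡⟨ ∑-cong (suc n) (λ k _ → term k) ⟩
  ∑ (suc n) (λ k → ℕ→ℚ (n C k) * (x ^ℚ k * y ^ℚ (n ∸ k)))
    ∎
  where
  open ≡-Reasoning
  ×≡ℕ→ℚ* : ∀ m z → m ℚ-Mult.× z ≡ ℕ→ℚ m * z
  ×≡ℕ→ℚ* zero z = sym (ℚₚ.*-zeroˡ z)
  ×≡ℕ→ℚ* (suc m) z = begin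
    z + m ℚ-Mult.× z  ≡⟨ cong (z +_) (×≡ℕ→ℚ* m z) ⟩
    z + ℕ→ℚ m * z         ≡⟨ solve 2 (λ z m → z :+ m :* z := (con 1ℚ :+ m) :* z) refl z (ℕ→ℚ m) ⟩
    (1ℚ + ℕ→ℚ m) * z      ≡⟨ cong (_* z) (sym (ℕ→ℚ-suc m)) ⟩
    ℕ→ℚ (suc m) * z       ∎
  term : ∀ k → (n C k) ℚ-Mult.× (x ℚ-Exp.^ k * y ℚ-Exp.^ (n ∸ k)) ≡ ℕ→ℚ (n C k) * (x ^ℚ k * y ^ℚ (n ∸ k))
  term k = trans (×≡ℕ→ℚ* (n C k) _) (cong (ℕ→ℚ (n C k) *_) (sym (cong₂ _*_ (^ℚ≡^ x k) (^ℚ≡^ y (n ∸ k)))))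

binomial-theorem-1 : ∀ x n → (x + 1ℚ) ^ℚ n ≡ ∑ (suc n) (λ k → ℕ→ℚ (n C k) * x ^ℚ k)
binomial-theorem-1 x n = trans (binomial-theorem x 1ℚ n) (∑-cong (suc n) (λ k _ →
  cong (ℕ→ℚ (n C k) *_) (trans (cong (x ^ℚ k *_) (1^ℚn≡1 (n ∸ k))) (ℚₚ.*-identityʳ (x ^ℚ k)))))

∑*∑≡∑∑* : ∀ m n f g → ∑ m f * ∑ n g ≡ ∑ m (λ i → ∑ n (λ j → f i * g j))
∑*∑≡∑∑* m n f g =
  trans (*-distribʳ-∑ m (∑ n g) f) (∑-cong m (λ i _ → *-distribˡ-∑ n (f i) g))

infix 9 [_]·_

[_]·_ : Bool → ℚ → ℚ
[ c ]· x = if c then x else 0ℚ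

[]·-*ʳ : ∀ c x y → [ c ]· x * y ≡ [ c ]· (x * y)
[]·-*ʳ true x y = refl
[]·-*ʳ false x y = ℚₚ.*-zeroˡ y

[]·-*ˡ : ∀ c x y → x * [ c ]· y ≡ [ c ]· (x * y)
[]·-*ˡ true x y = refl
[]·-*ˡ false x y = ℚₚ.*-zeroʳ x

[]·-distrib-+ : ∀ c x y → [ c ]· (x + y) ≡ [ c ]· x + [ c ]· y
[]·-distrib-+ true x y = refl
[]·-distrib-+ false x y = sym (ℚₚ.+-identityˡ 0ℚ)

[]·-distrib-- : ∀ c x y → [ c ]· (x - y) ≡ [ c ]· x - [ c ]· y
[]·-distrib-- true x y = refl
[]·-distrib-- false x y = refl

[]·-nonNeg : ∀ c → 0ℚ ≤ x → 0ℚ ≤ [ c ]· x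
[]·-nonNeg true 0≤x = 0≤x
[]·-nonNeg false 0≤x = ℚₚ.≤-refl

[]·-mono-≤ : ∀ c → x ≤ y → [ c ]· x ≤ [ c ]· y
[]·-mono-≤ true x≤y = x≤y
[]·-mono-≤ false x≤y = ℚₚ.≤-refl

[]·x≤x : ∀ c → 0ℚ ≤ x → [ c ]· x ≤ x
[]·x≤x true 0≤x = ℚₚ.≤-refl
[]·x≤x false 0≤x = 0≤x

∑-[]· : ∀ n c g → ∑ n (λ j → [ c ]· g j) ≡ [ c ]· ∑ n g
∑-[]· n true g = refl
∑-[]· n false g = ∑-zero n

sumℚ-count : ∀ {n} (p : Subset n) → sumℚ (tabulate (λ i → [ Data.Vec.lookup p i ]· 1ℚ)) ≡ ℕ→ℚ ∣ p ∣
sumℚ-count [] = refl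
sumℚ-count (true ∷ p) = trans (cong (1ℚ +_) (sumℚ-count p)) (sym (ℕ→ℚ-suc ∣ p ∣))
sumℚ-count (false ∷ p) = trans (ℚₚ.+-identityˡ _) (sumℚ-count p)

[]·-∧ : ∀ c c′ x y → [ c ∧ c′ ]· (x * y) ≡ [ c ]· x * [ c′ ]· y
[]·-∧ true true x y = refl
[]·-∧ true false x y = sym (ℚₚ.*-zeroʳ x)
[]·-∧ false c′ x y = sym (ℚₚ.*-zeroˡ ([ c′ ]· y))

-- Base-b expansions

≤ᵇ-suc : ∀ m n → (suc m ℕ.≤ᵇ suc n) ≡ (m ℕ.≤ᵇ n)
≤ᵇ-suc zero n = refl
≤ᵇ-suc (suc m) n = refl

module DigitSet (b : ℕ) (hb : 1 ℕ.< b) (A : Subset b) where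

  open Base b hb A

  0<b : 0 ℕ.< b
  0<b = ℕₚ.<-trans (s≤s z≤n) hb

  n<b^n : ∀ n → n ℕ.< b ℕ.^ n
  n<b^n zero = s≤s z≤n
  n<b^n (suc n) = begin
    suc (suc n)              ≡⟨ ℕₚ.+-comm 1 (suc n) ⟩
    suc n ℕ.+ 1              ≤⟨ ℕₚ.+-mono-≤ (n<b^n n) (ℕₚ.m^n>0 b n) ⟩
    b ℕ.^ n ℕ.+ b ℕ.^ n      ≡⟨ cong (b ℕ.^ n ℕ.+_) (sym (ℕₚ.+-identityʳ (b ℕ.^ n))) ⟩
    2 ℕ.* b ℕ.^ n            ≤⟨ ℕₚ.*-monoˡ-≤ (b ℕ.^ n) hb ⟩
    b ℕ.* b ℕ.^ n            ∎
    where open ℕₚ.≤-Reasoning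

  search : ℕ → ℕ → ℕ → ℕ
  search n zero l = l
  search n (suc k) l = if n ℕ.<ᵇ b ℕ.^ l then l else search n k (suc l)

  search-unique : (go : ℕ → ℕ → ℕ → ℕ) →
    (∀ n l → go n zero l ≡ l) →
    (∀ n k l → go n (suc k) l ≡ (if n ℕ.<ᵇ b ℕ.^ l then l else go n k (suc l))) →
    ∀ n k l → go n k l ≡ search n k l
  search-unique go go-zero go-suc n zero l = go-zero n l
  search-unique go go-zero go-suc n (suc k) l
    rewrite go-suc n k l | search-unique go go-zero go-suc n k (suc l) = refl

  -- `len` is computed by a search local to its definition, which cannot be named here.
  -- Once its arguments are abstracted to variables, unification solves `lenSearch`
  -- as that local function, and `search-unique` applies to it.
  mutual
    lenSearch : ℕ → ℕ → ℕ → ℕ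
    lenSearch = _

    len≡search : ∀ n → len n ≡ search n (suc n) 0
    len≡search zero = refl
    len≡search (suc zero) = refl
    len≡search (suc (suc x)) with suc (suc x) | 3
    ... | n | l = cong (λ t → if n ℕ.<ᵇ b ℕ.* 1 then 1 else if n ℕ.<ᵇ b ℕ.* (b ℕ.* 1) then 2 else t)
                       (search-unique lenSearch (λ _ _ → refl) (λ _ _ _ → refl) n x l)

  IsLength : ℕ → ℕ → Set
  IsLength n L = n ℕ.< b ℕ.^ L × (∀ j → j ℕ.< L → b ℕ.^ j ℕ.≤ n)

  isLength-unique : ∀ {n L L′} → IsLength n L → IsLength n L′ → L ≡ L′
  isLength-unique {L = L} {L′} (n<b^L , b^<L≤n) (n<b^L′ , b^<L′≤n) with ℕₚ.<-cmp L L′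
  ... | tri< L<L′ _ _ = ⊥-elim (ℕₚ.<-irrefl refl (ℕₚ.<-≤-trans n<b^L (b^<L′≤n L L<L′)))
  ... | tri≈ _ L≡L′ _ = L≡L′
  ... | tri> _ _ L′<L = ⊥-elim (ℕₚ.<-irrefl refl (ℕₚ.<-≤-trans n<b^L′ (b^<L≤n L′ L′<L)))

  search-isLength : ∀ n k l → (∀ j → j ℕ.< l → b ℕ.^ j ℕ.≤ n) → n ℕ.< b ℕ.^ (l ℕ.+ k) →
                    IsLength n (search n k l)
  search-isLength n zero l b^<l≤n n<b^l+0 = subst (λ t → n ℕ.< b ℕ.^ t) (ℕₚ.+-identityʳ l) n<b^l+0 , b^<l≤n
  search-isLength n (suc k) l b^<l≤n n<b^l+k+1 with n ℕ.<ᵇ b ℕ.^ l in eq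
  ... | true = ℕₚ.<ᵇ⇒< n (b ℕ.^ l) (subst T (sym eq) _) , b^<l≤n
  ... | false = search-isLength n k (suc l) b^<l+1≤n (subst (λ t → n ℕ.< b ℕ.^ t) (ℕₚ.+-suc l k) n<b^l+k+1)
    where
    b^<l+1≤n : ∀ j → j ℕ.< suc l → b ℕ.^ j ℕ.≤ n
    b^<l+1≤n j (s≤s j≤l) with ℕₚ.m≤n⇒m<n∨m≡n j≤l
    ... | inj₁ j<l = b^<l≤n j j<l
    ... | inj₂ refl = ℕₚ.≮⇒≥ (λ n<b^l → subst T eq (ℕₚ.<⇒<ᵇ n<b^l))

  len-isLength : ∀ n → IsLength n (len n)
  len-isLength n = subst (IsLength n) (sym (len≡search n))
    (search-isLength n (suc n) 0 (λ _ ()) (ℕₚ.<-trans (n<b^n n) (ℕₚ.^-monoʳ-< b hb (ℕₚ.n<1+n n))))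

  len-digit : ∀ {n} → 1 ℕ.≤ n → n ℕ.< b → len n ≡ 1
  len-digit {n} 1≤n n<b = isLength-unique (len-isLength n)
    (subst (n ℕ.<_) (sym (ℕₚ.*-identityʳ b)) n<b , λ { zero _ → 1≤n ; (suc j) (s≤s ()) })

  len-/ : ∀ {n} → b ℕ.≤ n → len n ≡ suc (len (n / b))
  len-/ {n} b≤n = isLength-unique (len-isLength n) (n<b^[1+L] , b^<1+L≤n)
    where
    L : ℕ
    L = len (n / b)
    n/b<b^L : n / b ℕ.< b ℕ.^ L
    n/b<b^L = proj₁ (len-isLength (n / b))
    n<b^[1+L] : n ℕ.< b ℕ.^ suc L
    n<b^[1+L] = begin-strict
      n                        ≡⟨ m≡m%n+[m/n]*n n b ⟩
      n % b ℕ.+ n / b ℕ.* b    <⟨ ℕₚ.+-monoˡ-< (n / b ℕ.* b) (m%n<n n b) ⟩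
      suc (n / b) ℕ.* b        ≤⟨ ℕₚ.*-monoˡ-≤ b n/b<b^L ⟩
      b ℕ.^ L ℕ.* b            ≡⟨ ℕₚ.*-comm (b ℕ.^ L) b ⟩
      b ℕ.^ suc L              ∎
      where open ℕₚ.≤-Reasoning
    b^<1+L≤n : ∀ j → j ℕ.< suc L → b ℕ.^ j ℕ.≤ n
    b^<1+L≤n zero _ = ℕₚ.≤-trans (ℕₚ.<⇒≤ hb) b≤n
    b^<1+L≤n (suc j) (s≤s j<L) = begin
      b ℕ.* b ℕ.^ j            ≡⟨ ℕₚ.*-comm b (b ℕ.^ j) ⟩
      b ℕ.^ j ℕ.* b            ≤⟨ ℕₚ.*-monoˡ-≤ b (proj₂ (len-isLength (n / b)) j j<L) ⟩
      n / b ℕ.* b              ≤⟨ m/n*n≤m n b ⟩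
      n                        ∎
      where open ℕₚ.≤-Reasoning

  inAℕ : ℕ → Bool
  inAℕ d with d ℕ.<? b
  ... | yes d<b = inA (fromℕ< d<b)
  ... | no _ = false

  inA≡inAℕ-toℕ : ∀ i → inA i ≡ inAℕ (toℕ i)
  inA≡inAℕ-toℕ i with toℕ i ℕ.<? b
  ... | yes i<b = cong inA (sym (Finₚ.fromℕ<-toℕ i i<b))
  ... | no i≮b = ⊥-elim (i≮b (Finₚ.toℕ<n i))

  inA-mod : ∀ n → inA (n mod b) ≡ inAℕ (n % b)
  inA-mod n = trans (inA≡inAℕ-toℕ (n mod b)) (cong inAℕ (Finₚ.toℕ-fromℕ< (m%n<n n b)))

  zeroInA≡inAℕ0 : zeroInA ≡ inAℕ 0
  zeroInA≡inAℕ0 = trans (inA≡inAℕ-toℕ (zeroFin hb)) (cong inAℕ (Finₚ.toℕ-fromℕ< 0<b))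

  paddedIn : ℕ → ℕ → Bool
  paddedIn zero n = true
  paddedIn (suc l) n = inAℕ (n % b) ∧ paddedIn l (n / b)

  paddedIn-leading : ∀ l {d n} → d ℕ.< b → n ℕ.< b ℕ.^ l →
                     paddedIn (suc l) (d ℕ.* b ℕ.^ l ℕ.+ n) ≡ inAℕ d ∧ paddedIn l n
  paddedIn-leading zero {d} {zero} d<b _
    rewrite ℕₚ.*-identityʳ d | ℕₚ.+-identityʳ d | m<n⇒m%n≡m d<b = refl
  paddedIn-leading zero {n = suc n} _ (s≤s ())
  paddedIn-leading (suc l) {d} {n} d<b n<b^[1+l] = begin
    inAℕ (z % b) ∧ paddedIn (suc l) (z / b)
      ≡⟨ cong₂ (λ r q → inAℕ r ∧ paddedIn (suc l) q) z%b≡n%b z/b≡d*b^l+n/b ⟩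
    inAℕ (n % b) ∧ paddedIn (suc l) (d ℕ.* b ℕ.^ l ℕ.+ n / b)
      ≡⟨ cong (inAℕ (n % b) ∧_) (paddedIn-leading l d<b n/b<b^l) ⟩
    inAℕ (n % b) ∧ (inAℕ d ∧ paddedIn l (n / b))
      ≡⟨ ∧-swap (inAℕ (n % b)) (inAℕ d) (paddedIn l (n / b)) ⟩
    inAℕ d ∧ paddedIn (suc l) n
      ∎
    where
    open ≡-Reasoning
    z : ℕ
    z = d ℕ.* b ℕ.^ suc l ℕ.+ n
    z≡n+d*b^l*b : z ≡ n ℕ.+ d ℕ.* b ℕ.^ l ℕ.* b
    z≡n+d*b^l*b = trans (ℕₚ.+-comm (d ℕ.* (b ℕ.* b ℕ.^ l)) n)
      (cong (n ℕ.+_) (trans (cong (d ℕ.*_) (ℕₚ.*-comm b (b ℕ.^ l))) (sym (ℕₚ.*-assoc d (b ℕ.^ l) b))))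
    z%b≡n%b : z % b ≡ n % b
    z%b≡n%b = trans (cong (_% b) z≡n+d*b^l*b) ([m+kn]%n≡m%n n (d ℕ.* b ℕ.^ l) b)
    z/b≡d*b^l+n/b : z / b ≡ d ℕ.* b ℕ.^ l ℕ.+ n / b
    z/b≡d*b^l+n/b = begin
      z / b                                         ≡⟨ cong (_/ b) z≡n+d*b^l*b ⟩
      (n ℕ.+ d ℕ.* b ℕ.^ l ℕ.* b) / b               ≡⟨ +-distrib-/-∣ʳ n (divides (d ℕ.* b ℕ.^ l) refl) ⟩
      n / b ℕ.+ d ℕ.* b ℕ.^ l ℕ.* b / b             ≡⟨ cong (n / b ℕ.+_) (m*n/n≡m (d ℕ.* b ℕ.^ l) b) ⟩
      n / b ℕ.+ d ℕ.* b ℕ.^ l                       ≡⟨ ℕₚ.+-comm (n / b) _ ⟩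
      d ℕ.* b ℕ.^ l ℕ.+ n / b                       ∎
    n/b<b^l : n / b ℕ.< b ℕ.^ l
    n/b<b^l = m<n*o⇒m/o<n (subst (n ℕ.<_) (ℕₚ.*-comm b (b ℕ.^ l)) n<b^[1+l])
    ∧-swap : ∀ x y z → x ∧ (y ∧ z) ≡ y ∧ (x ∧ z)
    ∧-swap x y z = trans (sym (Boolₚ.∧-assoc x y z))
      (trans (cong (_∧ z) (Boolₚ.∧-comm x y)) (Boolₚ.∧-assoc y x z))

  paddedIn-0 : ∀ l → paddedIn (suc l) 0 ≡ zeroInA
  paddedIn-0 l = begin
    inAℕ (0 % b) ∧ paddedIn l (0 / b)   ≡⟨ cong₂ (λ r q → inAℕ r ∧ paddedIn l q) (m<n⇒m%n≡m 0<b) (0/n≡0 b) ⟩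
    inAℕ 0 ∧ paddedIn l 0               ≡⟨ cong (_∧ paddedIn l 0) (sym zeroInA≡inAℕ0) ⟩
    zeroInA ∧ paddedIn l 0              ≡⟨ absorb l ⟩
    zeroInA                             ∎
    where
    open ≡-Reasoning
    absorb : ∀ l → zeroInA ∧ paddedIn l 0 ≡ zeroInA
    absorb zero = Boolₚ.∧-identityʳ zeroInA
    absorb (suc l) = trans (cong (zeroInA ∧_) (paddedIn-0 l)) (Boolₚ.∧-idem zeroInA)

  paddedIn≡digitsIn : ∀ l {n} k → 1 ℕ.≤ n → n ℕ.< b ℕ.^ l → n ℕ.≤ k →
                      paddedIn l n ≡ digitsIn k n ∧ (zeroInA ∨ (l ℕ.≤ᵇ len n))
  paddedIn≡digitsIn zero _ 1≤n n<1 _ = ⊥-elim (ℕₚ.<-irrefl refl (ℕₚ.≤-trans n<1 1≤n))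
  paddedIn≡digitsIn (suc l) {suc n} (suc k) 1≤n n<b^[1+l] n≤k with suc n ℕ.<? b
  ... | yes n<b rewrite m<n⇒m/n≡0 n<b | len-digit 1≤n n<b | sym (inA-mod (suc n)) = digit l
    where
    digit : ∀ l → inA (suc n mod b) ∧ paddedIn l 0 ≡ (inA (suc n mod b) ∧ true) ∧ (zeroInA ∨ (suc l ℕ.≤ᵇ 1))
    digit zero rewrite Boolₚ.∨-zeroʳ zeroInA | Boolₚ.∧-identityʳ (inA (suc n mod b)) = sym (Boolₚ.∧-identityʳ _)
    digit (suc l) rewrite paddedIn-0 l | Boolₚ.∨-identityʳ zeroInA | Boolₚ.∧-identityʳ (inA (suc n mod b)) = refl
  ... | no n≮b
    rewrite len-/ (ℕₚ.≮⇒≥ n≮b) | ≤ᵇ-suc l (len (suc n / b)) | sym (inA-mod (suc n))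
          | paddedIn≡digitsIn l k (m≥n⇒m/n>0 (ℕₚ.≮⇒≥ n≮b))
              (m<n*o⇒m/o<n (subst (suc n ℕ.<_) (ℕₚ.*-comm b (b ℕ.^ l)) n<b^[1+l]))
              (ℕₚ.<⇒≤pred (ℕₚ.<-≤-trans (m/n<m (suc n) b hb) n≤k))
    = sym (Boolₚ.∧-assoc (inA (suc n mod b)) (digitsIn k (suc n / b)) _)

  -- The atoms of μ at level l lying in [0,1) are the n / b^l with n < b^l and `paddedIn l n`.
  admissibleAtLevel≡paddedIn : ∀ l {n} → n ℕ.< b ℕ.^ l → zeroInA ≡ true ⊎ 1 ℕ.≤ l →
                               (admissible n ∧ (zeroInA ∨ (l ℕ.≤ᵇ len n))) ≡ paddedIn l n
  admissibleAtLevel≡paddedIn zero {zero} _ (inj₁ 0∈A) rewrite 0∈A = refl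
  admissibleAtLevel≡paddedIn (suc l) {zero} _ (inj₁ 0∈A) rewrite paddedIn-0 l | 0∈A = refl
  admissibleAtLevel≡paddedIn (suc l) {zero} _ (inj₂ _) rewrite paddedIn-0 l with zeroInA
  ... | true = refl
  ... | false = refl
  admissibleAtLevel≡paddedIn l {suc n} n<b^l _ = sym (paddedIn≡digitsIn l (suc n) (s≤s z≤n) n<b^l ℕₚ.≤-refl)

  N<b : A ≢ ⊤ → N ℕ.< b
  N<b A≢⊤ = ℕₚ.≤∧≢⇒< (Subsetₚ.∣p∣≤n A) (A≢⊤ ∘ Subsetₚ.∣p∣≡n⇒p≡⊤)

  inA≡true⇒∈ : ∀ {i} → inA i ≡ true → i ∈ A
  inA≡true⇒∈ {i} i∈A = Vecₚ.lookup⇒[]= i A i∈A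

  ∃nonDigit : A ≢ ⊤ → Σ[ z ∈ ℕ ] z ℕ.< b × inAℕ z ≡ false
  ∃nonDigit A≢⊤ with Finₚ.¬∀⟶∃¬ b (_∈ A) (_∈? A) (λ ∀∈A → A≢⊤ (Subsetₚ.⊆-antisym Subsetₚ.⊆⊤ (λ {i} _ → ∀∈A i)))
  ... | z , z∉A = toℕ z , Finₚ.toℕ<n z , trans (sym (inA≡inAℕ-toℕ z)) (Boolₚ.¬-not (z∉A ∘ inA≡true⇒∈))

  ∃nonzeroDigit : A ≢ ⁅ zeroFin hb ⁆ → Nonempty A → Σ[ a ∈ ℕ ] 1 ℕ.≤ a × inAℕ a ≡ true
  ∃nonzeroDigit A≢⁅0⁆ (x , x∈A) with Finₚ.¬∀⟶∃¬ b (λ i → i ∈ A → i ≡ 0F) (λ i → (i ∈? A) →-dec (i Finₚ.≟ 0F)) ∈A⇒≡0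
    where
    0F : Fin b
    0F = zeroFin hb
    ∈A⇒≡0 : ¬ (∀ i → i ∈ A → i ≡ 0F)
    ∈A⇒≡0 all0 = A≢⁅0⁆ (Subsetₚ.⊆-antisym
      (λ {i} i∈A → subst (_∈ ⁅ 0F ⁆) (sym (all0 i i∈A)) (Subsetₚ.x∈⁅x⁆ 0F))
      (λ {i} i∈⁅0⁆ → subst (_∈ A) (trans (all0 x x∈A) (sym (Subsetₚ.x∈⁅y⁆⇒x≡y 0F i∈⁅0⁆))) x∈A))
  ... | a , ¬[a∈A⇒a≡0] with a ∈? A
  ...   | no a∉A = ⊥-elim (¬[a∈A⇒a≡0] (⊥-elim ∘ a∉A))
  ...   | yes a∈A = toℕ a , ℕₚ.n≢0⇒n>0 toℕa≢0 , trans (sym (inA≡inAℕ-toℕ a)) (Vecₚ.[]=⇒lookup a∈A)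
    where
    toℕa≢0 : toℕ a ≢ 0
    toℕa≢0 toℕa≡0 = ¬[a∈A⇒a≡0] (λ _ → Finₚ.toℕ-injective (trans toℕa≡0 (sym (Finₚ.toℕ-fromℕ< _))))

  inAℕ-<b : ∀ {d} → inAℕ d ≡ true → d ℕ.< b
  inAℕ-<b {d} d∈A with d ℕ.<? b
  ... | yes d<b = d<b

  private
    maxStep : Fin b → ℕ → ℕ
    maxStep i acc = if inA i then toℕ i ℕ.⊔ acc else acc

  digit≤f : ∀ {d} → inAℕ d ≡ true → d ℕ.≤ f
  digit≤f {d} d∈A with d ℕ.<? b
  ... | yes d<b = subst (ℕ._≤ f) (Finₚ.toℕ-fromℕ< d<b) (≤foldr (allFin b) (∈-allFin (fromℕ< d<b)) d∈A)
    where
    ≤foldr : ∀ xs {i} → i ∈ₗ xs → inA i ≡ true → toℕ i ℕ.≤ foldr maxStep 0 xs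
    ≤foldr (x ∷ xs) (here refl) i∈A rewrite i∈A = ℕₚ.m≤m⊔n (toℕ x) (foldr maxStep 0 xs)
    ≤foldr (x ∷ xs) (there i∈xs) i∈A = ℕₚ.≤-trans (≤foldr xs i∈xs i∈A) (acc≤step (inA x))
      where
      acc≤step : ∀ c → foldr maxStep 0 xs ℕ.≤ (if c then toℕ x ℕ.⊔ foldr maxStep 0 xs else foldr maxStep 0 xs)
      acc≤step true = ℕₚ.m≤n⊔m (toℕ x) (foldr maxStep 0 xs)
      acc≤step false = ℕₚ.≤-refl

  f≡0⊎f∈A : f ≡ 0 ⊎ inAℕ f ≡ true
  f≡0⊎f∈A with foldr-attained (allFin b)
    where
    foldr-attained : ∀ xs → foldr maxStep 0 xs ≡ 0 ⊎ Σ[ i ∈ Fin b ] inA i ≡ true × toℕ i ≡ foldr maxStep 0 xs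
    foldr-attained [] = inj₁ refl
    foldr-attained (x ∷ xs) with inA x in x∈A? | foldr-attained xs
    ... | false | r = r
    ... | true | r with ℕₚ.⊔-sel (toℕ x) (foldr maxStep 0 xs)
    ...   | inj₁ x⊔≡x = inj₂ (x , x∈A? , sym x⊔≡x)
    ...   | inj₂ x⊔≡acc with r
    ...     | inj₁ acc≡0 = inj₁ (trans x⊔≡acc acc≡0)
    ...     | inj₂ (i , i∈A , i≡acc) = inj₂ (i , i∈A , trans i≡acc (sym x⊔≡acc))
  ... | inj₁ f≡0 = inj₁ f≡0
  ... | inj₂ (i , i∈A , i≡f) = inj₂ (subst (λ d → inAℕ d ≡ true) i≡f (trans (sym (inA≡inAℕ-toℕ i)) i∈A))

  -- Moments of μ

  ∑A : (ℕ → ℚ) → ℚ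
  ∑A g = ∑ b (λ d → [ inAℕ d ]· g d)

  γ≡∑A : ∀ j → γ j ≡ ∑A (λ a → ℕ→ℚ a ^ℚ j)
  γ≡∑A j = sumℚ-map-allFin b _ _ term
    where
    term : ∀ i → (if inA i then ℕ→ℚ (toℕ i ℕ.^ j) else 0ℚ) ≡ [ inAℕ (toℕ i) ]· (ℕ→ℚ (toℕ i) ^ℚ j)
    term i rewrite inA≡inAℕ-toℕ i = cong ([ inAℕ (toℕ i) ]·_) (ℕ→ℚ-homo-^ (toℕ i) j)

  γ0≡N : γ 0 ≡ ℕ→ℚ N
  γ0≡N = trans (cong sumℚ (map-tabulate (λ i → i) (λ i → [ inA i ]· 1ℚ))) (sumℚ-count A)

  ∑A-distrib-+ : ∀ g h → ∑A (λ a → g a + h a) ≡ ∑A g + ∑A h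
  ∑A-distrib-+ g h = trans (∑-cong b (λ d _ → []·-distrib-+ (inAℕ d) (g d) (h d))) (∑-distrib-+ b _ _)

  ∑A-distrib-- : ∀ g h → ∑A (λ a → g a - h a) ≡ ∑A g - ∑A h
  ∑A-distrib-- g h = trans (∑-cong b (λ d _ → []·-distrib-- (inAℕ d) (g d) (h d))) (∑-distrib-- b _ _)

  *-distribˡ-∑A : ∀ x g → x * ∑A g ≡ ∑A (λ a → x * g a)
  *-distribˡ-∑A x g = trans (*-distribˡ-∑ b x _) (∑-cong b (λ d _ → []·-*ˡ (inAℕ d) x (g d)))

  *-distribʳ-∑A : ∀ x g → ∑A g * x ≡ ∑A (λ a → g a * x)
  *-distribʳ-∑A x g = trans (*-distribʳ-∑ b x _) (∑-cong b (λ d _ → []·-*ʳ (inAℕ d) (g d) x))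

  ∑-∑A-comm : ∀ n (h : ℕ → ℕ → ℚ) → ∑ n (λ j → ∑A (h j)) ≡ ∑A (λ a → ∑ n (λ j → h j a))
  ∑-∑A-comm n h = trans (∑-comm n b (λ j d → [ inAℕ d ]· h j d)) (∑-cong b (λ d _ → ∑-[]· n (inAℕ d) (λ j → h j d)))

  ∑A-mono-≤ : ∀ {g h} → (∀ a → a ℕ.< b → g a ≤ h a) → ∑A g ≤ ∑A h
  ∑A-mono-≤ g≤h = ∑-mono-≤ b (λ d d<b → []·-mono-≤ (inAℕ d) (g≤h d d<b))

  ∑A-nonNeg : ∀ {g} → (∀ a → 0ℚ ≤ g a) → 0ℚ ≤ ∑A g
  ∑A-nonNeg 0≤g = ∑-nonNeg b (λ d _ → []·-nonNeg (inAℕ d) (0≤g d))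

  term≤∑A : ∀ {g a} → inAℕ a ≡ true → a ℕ.< b → (∀ d → 0ℚ ≤ g d) → g a ≤ ∑A g
  term≤∑A {g} {a} a∈A a<b 0≤g = subst (λ c → [ c ]· g a ≤ ∑A g) a∈A
    (term≤∑ b a (λ d _ → []·-nonNeg (inAℕ d) (0≤g d)) a<b)

  ∑A-const : ∀ x → ∑A (λ _ → x) ≡ ℕ→ℚ N * x
  ∑A-const x = begin
    ∑A (λ _ → x)                 ≡⟨ ∑-cong b (λ d _ → cong ([ inAℕ d ]·_) (sym (ℚₚ.*-identityˡ x))) ⟩
    ∑A (λ a → ℕ→ℚ a ^ℚ 0 * x)    ≡⟨ sym (*-distribʳ-∑A x _) ⟩
    ∑A (λ a → ℕ→ℚ a ^ℚ 0) * x    ≡⟨ cong (_* x) (trans (sym (γ≡∑A 0)) γ0≡N) ⟩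
    ℕ→ℚ N * x                    ∎
    where open ≡-Reasoning

  γ-nonNeg : ∀ j → 0ℚ ≤ γ j
  γ-nonNeg j = subst (0ℚ ≤_) (sym (γ≡∑A j)) (∑A-nonNeg (λ a → ^ℚ-nonNeg j (ℕ→ℚ-nonNeg a)))

  ∑-binomial-γ : ∀ c m → ∑ (suc m) (λ j → ℕ→ℚ (m C j) * (γ j * c ^ℚ j)) ≡ ∑A (λ a → (ℕ→ℚ a * c + 1ℚ) ^ℚ m)
  ∑-binomial-γ c m = begin
    ∑ (suc m) (λ j → ℕ→ℚ (m C j) * (γ j * c ^ℚ j))
      ≡⟨ ∑-cong (suc m) (λ j _ → term j) ⟩
    ∑ (suc m) (λ j → ∑A (λ a → ℕ→ℚ (m C j) * (ℕ→ℚ a * c) ^ℚ j))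
      ≡⟨ ∑-∑A-comm (suc m) (λ j a → ℕ→ℚ (m C j) * (ℕ→ℚ a * c) ^ℚ j) ⟩
    ∑A (λ a → ∑ (suc m) (λ j → ℕ→ℚ (m C j) * (ℕ→ℚ a * c) ^ℚ j))
      ≡⟨ ∑-cong b (λ d _ → cong ([ inAℕ d ]·_) (sym (binomial-theorem-1 (ℕ→ℚ d * c) m))) ⟩
    ∑A (λ a → (ℕ→ℚ a * c + 1ℚ) ^ℚ m)
      ∎
    where
    open ≡-Reasoning
    term : ∀ j → ℕ→ℚ (m C j) * (γ j * c ^ℚ j) ≡ ∑A (λ a → ℕ→ℚ (m C j) * (ℕ→ℚ a * c) ^ℚ j)
    term j = begin
      ℕ→ℚ (m C j) * (γ j * c ^ℚ j)
        ≡⟨ cong (λ t → ℕ→ℚ (m C j) * (t * c ^ℚ j)) (γ≡∑A j) ⟩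
      ℕ→ℚ (m C j) * (∑A (λ a → ℕ→ℚ a ^ℚ j) * c ^ℚ j)
        ≡⟨ cong (ℕ→ℚ (m C j) *_) (*-distribʳ-∑A (c ^ℚ j) _) ⟩
      ℕ→ℚ (m C j) * ∑A (λ a → ℕ→ℚ a ^ℚ j * c ^ℚ j)
        ≡⟨ *-distribˡ-∑A (ℕ→ℚ (m C j)) _ ⟩
      ∑A (λ a → ℕ→ℚ (m C j) * (ℕ→ℚ a ^ℚ j * c ^ℚ j))
        ≡⟨ ∑-cong b (λ d _ → cong (λ t → [ inAℕ d ]· (ℕ→ℚ (m C j) * t)) (sym (^ℚ-distrib-* (ℕ→ℚ d) c j))) ⟩
      ∑A (λ a → ℕ→ℚ (m C j) * (ℕ→ℚ a * c) ^ℚ j)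
        ∎

  powerSum : ℕ → ℕ → ℚ
  powerSum m l = ∑ (b ℕ.^ l) (λ n → [ paddedIn l n ]· (ℕ→ℚ n ^ℚ m))

  paddedPower-leading : ∀ m l {d n} → d ℕ.< b → n ℕ.< b ℕ.^ l →
    [ paddedIn (suc l) (d ℕ.* b ℕ.^ l ℕ.+ n) ]· (ℕ→ℚ (d ℕ.* b ℕ.^ l ℕ.+ n) ^ℚ m) ≡
    ∑ (suc m) (λ j → ℕ→ℚ (m C j) * (bℚ ^ℚ l) ^ℚ j * [ inAℕ d ]· (ℕ→ℚ d ^ℚ j) * [ paddedIn l n ]· (ℕ→ℚ n ^ℚ (m ∸ j)))
  paddedPower-leading m l {d} {n} d<b n<b^l = begin
    [ paddedIn (suc l) (d ℕ.* b ℕ.^ l ℕ.+ n) ]· (ℕ→ℚ (d ℕ.* b ℕ.^ l ℕ.+ n) ^ℚ m)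
      ≡⟨ cong₂ [_]·_ (paddedIn-leading l d<b n<b^l) (cong (_^ℚ m) value) ⟩
    [ inAℕ d ∧ paddedIn l n ]· ((ℕ→ℚ d * bℚ ^ℚ l + ℕ→ℚ n) ^ℚ m)
      ≡⟨ cong ([ inAℕ d ∧ paddedIn l n ]·_) (binomial-theorem (ℕ→ℚ d * bℚ ^ℚ l) (ℕ→ℚ n) m) ⟩
    [ inAℕ d ∧ paddedIn l n ]· ∑ (suc m) binomialTerm
      ≡⟨ sym (∑-[]· (suc m) (inAℕ d ∧ paddedIn l n) binomialTerm) ⟩
    ∑ (suc m) (λ j → [ inAℕ d ∧ paddedIn l n ]· binomialTerm j)
      ≡⟨ ∑-cong (suc m) (λ j _ → term j) ⟩
    ∑ (suc m) (λ j → c j * [ inAℕ d ]· (ℕ→ℚ d ^ℚ j) * rest j)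
      ∎
    where
    open ≡-Reasoning
    c : ℕ → ℚ
    c j = ℕ→ℚ (m C j) * (bℚ ^ℚ l) ^ℚ j
    rest : ℕ → ℚ
    rest j = [ paddedIn l n ]· (ℕ→ℚ n ^ℚ (m ∸ j))
    binomialTerm : ℕ → ℚ
    binomialTerm j = ℕ→ℚ (m C j) * ((ℕ→ℚ d * bℚ ^ℚ l) ^ℚ j * ℕ→ℚ n ^ℚ (m ∸ j))
    value : ℕ→ℚ (d ℕ.* b ℕ.^ l ℕ.+ n) ≡ ℕ→ℚ d * bℚ ^ℚ l + ℕ→ℚ n
    value = trans (ℕ→ℚ-homo-+ (d ℕ.* b ℕ.^ l) n)
      (cong (_+ ℕ→ℚ n) (trans (ℕ→ℚ-homo-* d (b ℕ.^ l)) (cong (ℕ→ℚ d *_) (ℕ→ℚ-homo-^ b l))))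
    term : ∀ j → [ inAℕ d ∧ paddedIn l n ]· binomialTerm j ≡ c j * [ inAℕ d ]· (ℕ→ℚ d ^ℚ j) * rest j
    term j = begin
      [ inAℕ d ∧ paddedIn l n ]· (ℕ→ℚ (m C j) * ((ℕ→ℚ d * bℚ ^ℚ l) ^ℚ j * ℕ→ℚ n ^ℚ (m ∸ j)))
        ≡⟨ cong (λ t → [ inAℕ d ∧ paddedIn l n ]· (ℕ→ℚ (m C j) * (t * ℕ→ℚ n ^ℚ (m ∸ j))))
             (^ℚ-distrib-* (ℕ→ℚ d) (bℚ ^ℚ l) j) ⟩
      [ inAℕ d ∧ paddedIn l n ]· (ℕ→ℚ (m C j) * (ℕ→ℚ d ^ℚ j * (bℚ ^ℚ l) ^ℚ j * ℕ→ℚ n ^ℚ (m ∸ j)))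
        ≡⟨ cong ([ inAℕ d ∧ paddedIn l n ]·_)
             (solve 4 (λ C x y z → C :* (x :* y :* z) := (C :* y) :* x :* z) refl
                (ℕ→ℚ (m C j)) (ℕ→ℚ d ^ℚ j) ((bℚ ^ℚ l) ^ℚ j) (ℕ→ℚ n ^ℚ (m ∸ j))) ⟩
      [ inAℕ d ∧ paddedIn l n ]· (c j * ℕ→ℚ d ^ℚ j * ℕ→ℚ n ^ℚ (m ∸ j))
        ≡⟨ []·-∧ (inAℕ d) (paddedIn l n) (c j * ℕ→ℚ d ^ℚ j) (ℕ→ℚ n ^ℚ (m ∸ j)) ⟩
      [ inAℕ d ]· (c j * ℕ→ℚ d ^ℚ j) * rest j
        ≡⟨ cong (_* rest j) (sym ([]·-*ˡ (inAℕ d) (c j) (ℕ→ℚ d ^ℚ j))) ⟩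
      c j * [ inAℕ d ]· (ℕ→ℚ d ^ℚ j) * rest j
        ∎

  powerSum-suc : ∀ m l → powerSum m (suc l) ≡
    ∑ (suc m) (λ j → ℕ→ℚ (m C j) * (bℚ ^ℚ l) ^ℚ j * γ j * powerSum (m ∸ j) l)
  powerSum-suc m l = begin
    ∑ (b ℕ.* b ℕ.^ l) h
      ≡⟨ ∑-double b (b ℕ.^ l) h ⟩
    ∑ b (λ d → ∑ (b ℕ.^ l) (λ n → h (d ℕ.* b ℕ.^ l ℕ.+ n)))
      ≡⟨ ∑-cong b (λ d d<b → ∑-cong (b ℕ.^ l) (λ n n<b^l → paddedPower-leading m l d<b n<b^l)) ⟩
    ∑ b (λ d → ∑ (b ℕ.^ l) (λ n → ∑ (suc m) (λ j → c j * digit j d * rest j n)))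
      ≡⟨ ∑-cong b (λ d _ → ∑-comm (b ℕ.^ l) (suc m) (λ n j → c j * digit j d * rest j n)) ⟩
    ∑ b (λ d → ∑ (suc m) (λ j → ∑ (b ℕ.^ l) (λ n → c j * digit j d * rest j n)))
      ≡⟨ ∑-comm b (suc m) (λ d j → ∑ (b ℕ.^ l) (λ n → c j * digit j d * rest j n)) ⟩
    ∑ (suc m) (λ j → ∑ b (λ d → ∑ (b ℕ.^ l) (λ n → c j * digit j d * rest j n)))
      ≡⟨ ∑-cong (suc m) (λ j _ → factor j) ⟩
    ∑ (suc m) (λ j → c j * γ j * powerSum (m ∸ j) l)
      ∎
    where
    open ≡-Reasoning
    h : ℕ → ℚ
    h n = [ paddedIn (suc l) n ]· (ℕ→ℚ n ^ℚ m)
    c : ℕ → ℚ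
    c j = ℕ→ℚ (m C j) * (bℚ ^ℚ l) ^ℚ j
    digit : ℕ → ℕ → ℚ
    digit j d = [ inAℕ d ]· (ℕ→ℚ d ^ℚ j)
    rest : ℕ → ℕ → ℚ
    rest j n = [ paddedIn l n ]· (ℕ→ℚ n ^ℚ (m ∸ j))
    factor : ∀ j → ∑ b (λ d → ∑ (b ℕ.^ l) (λ n → c j * digit j d * rest j n)) ≡ c j * γ j * powerSum (m ∸ j) l
    factor j = begin
      ∑ b (λ d → ∑ (b ℕ.^ l) (λ n → c j * digit j d * rest j n))
        ≡⟨ sym (∑*∑≡∑∑* b (b ℕ.^ l) (λ d → c j * digit j d) (rest j)) ⟩
      ∑ b (λ d → c j * digit j d) * powerSum (m ∸ j) l
        ≡⟨ cong (_* powerSum (m ∸ j) l) (sym (*-distribˡ-∑ b (c j) (digit j))) ⟩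
      c j * ∑A (λ a → ℕ→ℚ a ^ℚ j) * powerSum (m ∸ j) l
        ≡⟨ cong (λ t → c j * t * powerSum (m ∸ j) l) (sym (γ≡∑A j)) ⟩
      c j * γ j * powerSum (m ∸ j) l
        ∎

  0<bℚ : 0ℚ < bℚ
  0<bℚ = ℕ→ℚ-mono-< {0} {b} 0<b

  1≤bℚ : 1ℚ ≤ bℚ
  1≤bℚ = ℕ→ℚ-mono-≤ {1} {b} (ℕₚ.<⇒≤ hb)

  bℚ≢0 : bℚ ≢ 0ℚ
  bℚ≢0 bℚ≡0 = ℚₚ.<⇒≢ 0<bℚ (sym bℚ≡0)

  β : ℚ
  β = bℚ ⁻¹

  β^n*bℚ^n≡1 : ∀ n → β ^ℚ n * bℚ ^ℚ n ≡ 1ℚ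
  β^n*bℚ^n≡1 n = begin
    β ^ℚ n * bℚ ^ℚ n   ≡⟨ sym (^ℚ-distrib-* β bℚ n) ⟩
    (β * bℚ) ^ℚ n      ≡⟨ cong (_^ℚ n) (⁻¹-inverseˡ bℚ≢0) ⟩
    1ℚ ^ℚ n            ≡⟨ 1^ℚn≡1 n ⟩
    1ℚ                 ∎
    where open ≡-Reasoning

  -- Σ_{a ∈ A} ∫ (x + a)^m dν(x), for a measure ν with moments v.
  shifted : ℕ → (ℕ → ℚ) → ℚ
  shifted m v = ∑ (suc m) (λ j → ℕ→ℚ (m C j) * (γ j * v (m ∸ j)))

  ∑-shifted : ∀ L m (v : ℕ → ℕ → ℚ) → ∑ L (λ l → shifted m (v l)) ≡ shifted m (λ k → ∑ L (λ l → v l k))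
  ∑-shifted L m v = begin
    ∑ L (λ l → ∑ (suc m) (λ j → ℕ→ℚ (m C j) * (γ j * v l (m ∸ j))))
      ≡⟨ ∑-comm L (suc m) (λ l j → ℕ→ℚ (m C j) * (γ j * v l (m ∸ j))) ⟩
    ∑ (suc m) (λ j → ∑ L (λ l → ℕ→ℚ (m C j) * (γ j * v l (m ∸ j))))
      ≡⟨ ∑-cong (suc m) (λ j _ → sym (trans (cong (ℕ→ℚ (m C j) *_) (*-distribˡ-∑ L (γ j) (λ l → v l (m ∸ j))))
                                            (*-distribˡ-∑ L (ℕ→ℚ (m C j)) (λ l → γ j * v l (m ∸ j))))) ⟩
    ∑ (suc m) (λ j → ℕ→ℚ (m C j) * (γ j * ∑ L (λ l → v l (m ∸ j))))
      ∎
    where open ≡-Reasoning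

  -- ∫ x^m dμ over [0,1), restricted to the atoms of the levels l < L.
  levelSum : ℕ → ℕ → ℚ
  levelSum L m = ∑ L (λ l → (β ^ℚ l) ^ℚ suc m * powerSum m l)

  weight-shift : ∀ l {m j} → j ℕ.≤ m →
                 (β ^ℚ suc l) ^ℚ suc m * (bℚ ^ℚ l) ^ℚ j ≡ β ^ℚ suc m * (β ^ℚ l) ^ℚ suc (m ∸ j)
  weight-shift l {m} {j} j≤m = begin
    (β * β ^ℚ l) ^ℚ suc m * (bℚ ^ℚ l) ^ℚ j
      ≡⟨ cong (_* (bℚ ^ℚ l) ^ℚ j) (^ℚ-distrib-* β (β ^ℚ l) (suc m)) ⟩
    β ^ℚ suc m * (β ^ℚ l) ^ℚ suc m * (bℚ ^ℚ l) ^ℚ j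
      ≡⟨ cong (λ t → β ^ℚ suc m * t * (bℚ ^ℚ l) ^ℚ j)
           (trans (cong ((β ^ℚ l) ^ℚ_) (cong suc (sym (ℕₚ.m∸n+n≡m j≤m)))) (^ℚ-homo-* (β ^ℚ l) (suc (m ∸ j)) j)) ⟩
    β ^ℚ suc m * ((β ^ℚ l) ^ℚ suc (m ∸ j) * (β ^ℚ l) ^ℚ j) * (bℚ ^ℚ l) ^ℚ j
      ≡⟨ solve 4 (λ p q r s → p :* (q :* r) :* s := p :* q :* (r :* s)) refl
           (β ^ℚ suc m) ((β ^ℚ l) ^ℚ suc (m ∸ j)) ((β ^ℚ l) ^ℚ j) ((bℚ ^ℚ l) ^ℚ j) ⟩
    β ^ℚ suc m * (β ^ℚ l) ^ℚ suc (m ∸ j) * ((β ^ℚ l) ^ℚ j * (bℚ ^ℚ l) ^ℚ j)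
      ≡⟨ cong (β ^ℚ suc m * (β ^ℚ l) ^ℚ suc (m ∸ j) *_)
           (trans (sym (^ℚ-distrib-* (β ^ℚ l) (bℚ ^ℚ l) j)) (trans (cong (_^ℚ j) (β^n*bℚ^n≡1 l)) (1^ℚn≡1 j))) ⟩
    β ^ℚ suc m * (β ^ℚ l) ^ℚ suc (m ∸ j) * 1ℚ
      ≡⟨ ℚₚ.*-identityʳ _ ⟩
    β ^ℚ suc m * (β ^ℚ l) ^ℚ suc (m ∸ j)
      ∎
    where open ≡-Reasoning

  levelTerm-suc : ∀ m l → (β ^ℚ suc l) ^ℚ suc m * powerSum m (suc l) ≡
                          β ^ℚ suc m * shifted m (λ k → (β ^ℚ l) ^ℚ suc k * powerSum k l)
  levelTerm-suc m l = begin
    w * powerSum m (suc l)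
      ≡⟨ cong (w *_) (powerSum-suc m l) ⟩
    w * ∑ (suc m) (λ j → ℕ→ℚ (m C j) * (bℚ ^ℚ l) ^ℚ j * γ j * powerSum (m ∸ j) l)
      ≡⟨ *-distribˡ-∑ (suc m) w (λ j → ℕ→ℚ (m C j) * (bℚ ^ℚ l) ^ℚ j * γ j * powerSum (m ∸ j) l) ⟩
    ∑ (suc m) (λ j → w * (ℕ→ℚ (m C j) * (bℚ ^ℚ l) ^ℚ j * γ j * powerSum (m ∸ j) l))
      ≡⟨ ∑-cong (suc m) (λ j j≤m → term j (ℕₚ.<⇒≤pred j≤m)) ⟩
    ∑ (suc m) (λ j → β ^ℚ suc m * (ℕ→ℚ (m C j) * (γ j * ((β ^ℚ l) ^ℚ suc (m ∸ j) * powerSum (m ∸ j) l))))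
      ≡⟨ sym (*-distribˡ-∑ (suc m) (β ^ℚ suc m) (λ j → ℕ→ℚ (m C j) * (γ j * ((β ^ℚ l) ^ℚ suc (m ∸ j) * powerSum (m ∸ j) l)))) ⟩
    β ^ℚ suc m * shifted m (λ k → (β ^ℚ l) ^ℚ suc k * powerSum k l)
      ∎
    where
    open ≡-Reasoning
    w : ℚ
    w = (β ^ℚ suc l) ^ℚ suc m
    term : ∀ j → j ℕ.≤ m →
           w * (ℕ→ℚ (m C j) * (bℚ ^ℚ l) ^ℚ j * γ j * powerSum (m ∸ j) l) ≡
           β ^ℚ suc m * (ℕ→ℚ (m C j) * (γ j * ((β ^ℚ l) ^ℚ suc (m ∸ j) * powerSum (m ∸ j) l)))
    term j j≤m = begin
      w * (ℕ→ℚ (m C j) * (bℚ ^ℚ l) ^ℚ j * γ j * powerSum (m ∸ j) l)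
        ≡⟨ solve 5 (λ w c p g s → w :* (c :* p :* g :* s) := w :* p :* (c :* g :* s)) refl
             w (ℕ→ℚ (m C j)) ((bℚ ^ℚ l) ^ℚ j) (γ j) (powerSum (m ∸ j) l) ⟩
      w * (bℚ ^ℚ l) ^ℚ j * (ℕ→ℚ (m C j) * γ j * powerSum (m ∸ j) l)
        ≡⟨ cong (_* (ℕ→ℚ (m C j) * γ j * powerSum (m ∸ j) l)) (weight-shift l j≤m) ⟩
      β ^ℚ suc m * (β ^ℚ l) ^ℚ suc (m ∸ j) * (ℕ→ℚ (m C j) * γ j * powerSum (m ∸ j) l)
        ≡⟨ solve 5 (λ e w c g s → e :* w :* (c :* g :* s) := e :* (c :* (g :* (w :* s)))) refl
             (β ^ℚ suc m) ((β ^ℚ l) ^ℚ suc (m ∸ j)) (ℕ→ℚ (m C j)) (γ j) (powerSum (m ∸ j) l) ⟩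
      β ^ℚ suc m * (ℕ→ℚ (m C j) * (γ j * ((β ^ℚ l) ^ℚ suc (m ∸ j) * powerSum (m ∸ j) l)))
        ∎

  levelTerm-0 : ∀ m → (β ^ℚ 0) ^ℚ suc m * powerSum m 0 ≡ 0ℚ ^ℚ m
  levelTerm-0 m = trans (cong₂ _*_ (1^ℚn≡1 (suc m)) (ℚₚ.+-identityʳ (0ℚ ^ℚ m))) (ℚₚ.*-identityˡ (0ℚ ^ℚ m))

  levelSum-suc : ∀ L m → levelSum (suc L) m ≡ 0ℚ ^ℚ m + β ^ℚ suc m * shifted m (λ k → levelSum L k)
  levelSum-suc L m = cong₂ _+_ (levelTerm-0 m) (begin
    ∑ L (λ l → (β ^ℚ suc l) ^ℚ suc m * powerSum m (suc l))
      ≡⟨ ∑-cong L (λ l _ → levelTerm-suc m l) ⟩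
    ∑ L (λ l → β ^ℚ suc m * shifted m (λ k → (β ^ℚ l) ^ℚ suc k * powerSum k l))
      ≡⟨ sym (*-distribˡ-∑ L (β ^ℚ suc m) (λ l → shifted m (λ k → (β ^ℚ l) ^ℚ suc k * powerSum k l))) ⟩
    β ^ℚ suc m * ∑ L (λ l → shifted m (λ k → (β ^ℚ l) ^ℚ suc k * powerSum k l))
      ≡⟨ cong (β ^ℚ suc m *_) (∑-shifted L m (λ l k → (β ^ℚ l) ^ℚ suc k * powerSum k l)) ⟩
    β ^ℚ suc m * shifted m (λ k → levelSum L k)
      ∎)
    where open ≡-Reasoning

  [bℚ^l]⁻¹≡β^l : ∀ l → (bℚ ^ℚ l) ⁻¹ ≡ β ^ℚ l
  [bℚ^l]⁻¹≡β^l = ⁻¹-distrib-^ℚ bℚ≢0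

  levelTerm≡ : ∀ m l → zeroInA ≡ true ⊎ 1 ℕ.≤ l → levelTerm m l ≡ (β ^ℚ l) ^ℚ suc m * powerSum m l
  levelTerm≡ m l 0∈A⊎1≤l = begin
    (bℚ ^ℚ l) ⁻¹ * sumℚ (map atom (upTo (b ℕ.^ l)))
      ≡⟨ cong₂ _*_ ([bℚ^l]⁻¹≡β^l l) (sumℚ-map-upTo (b ℕ.^ l) atom) ⟩
    β ^ℚ l * ∑ (b ℕ.^ l) atom
      ≡⟨ cong (β ^ℚ l *_) (∑-cong (b ℕ.^ l) atom≡) ⟩
    β ^ℚ l * ∑ (b ℕ.^ l) (λ n → [ paddedIn l n ]· (ℕ→ℚ n ^ℚ m) * (β ^ℚ l) ^ℚ m)
      ≡⟨ cong (β ^ℚ l *_) (sym (*-distribʳ-∑ (b ℕ.^ l) ((β ^ℚ l) ^ℚ m) (λ n → [ paddedIn l n ]· (ℕ→ℚ n ^ℚ m)))) ⟩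
    β ^ℚ l * (powerSum m l * (β ^ℚ l) ^ℚ m)
      ≡⟨ solve 3 (λ x s y → x :* (s :* y) := x :* y :* s) refl (β ^ℚ l) (powerSum m l) ((β ^ℚ l) ^ℚ m) ⟩
    (β ^ℚ l) ^ℚ suc m * powerSum m l
      ∎
    where
    open ≡-Reasoning
    atom : ℕ → ℚ
    atom n = [ admissible n ∧ (zeroInA ∨ (l ℕ.≤ᵇ len n)) ]· ((ℕ→ℚ n ÷₀ (bℚ ^ℚ l)) ^ℚ m)
    atom≡ : ∀ n → n ℕ.< b ℕ.^ l → atom n ≡ [ paddedIn l n ]· (ℕ→ℚ n ^ℚ m) * (β ^ℚ l) ^ℚ m
    atom≡ n n<b^l = begin
      atom n
        ≡⟨ cong₂ [_]·_ (admissibleAtLevel≡paddedIn l n<b^l 0∈A⊎1≤l)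
             (cong (_^ℚ m) (trans (x÷₀y≡x*y⁻¹ (ℕ→ℚ n) (bℚ ^ℚ l)) (cong (ℕ→ℚ n *_) ([bℚ^l]⁻¹≡β^l l)))) ⟩
      [ paddedIn l n ]· ((ℕ→ℚ n * β ^ℚ l) ^ℚ m)
        ≡⟨ cong ([ paddedIn l n ]·_) (^ℚ-distrib-* (ℕ→ℚ n) (β ^ℚ l) m) ⟩
      [ paddedIn l n ]· (ℕ→ℚ n ^ℚ m * (β ^ℚ l) ^ℚ m)
        ≡⟨ sym ([]·-*ʳ (paddedIn l n) (ℕ→ℚ n ^ℚ m) ((β ^ℚ l) ^ℚ m)) ⟩
      [ paddedIn l n ]· (ℕ→ℚ n ^ℚ m) * (β ^ℚ l) ^ℚ m
        ∎

  uPartial≡levelSum : ∀ m L → 1 ℕ.≤ L → uPartial m L ≡ levelSum L m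
  uPartial≡levelSum m L = by-zeroInA zeroInA refl
    where
    open ≡-Reasoning
    δ₀ : ℚ
    δ₀ = if zeroInA then 0ℚ else 0ℚ ^ℚ m
    by-zeroInA : ∀ c → zeroInA ≡ c → 1 ℕ.≤ L → uPartial m L ≡ levelSum L m
    by-zeroInA true 0∈A _ = begin
      δ₀ + sumRange 0 L (levelTerm m)
        ≡⟨ cong₂ _+_ (cong (λ c → if c then 0ℚ else 0ℚ ^ℚ m) 0∈A) (sumℚ-map-upTo L (levelTerm m)) ⟩
      0ℚ + ∑ L (levelTerm m)
        ≡⟨ trans (ℚₚ.+-identityˡ _) (∑-cong L (λ l _ → levelTerm≡ m l (inj₁ 0∈A))) ⟩
      levelSum L m
        ∎
    -- Here 0 is not admissible, so level 0 contributes nothing and δ₀ takes its place.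
    by-zeroInA false 0∉A (s≤s {n = L′} _) = begin
      δ₀ + sumRange 0 (suc L′) (levelTerm m)
        ≡⟨ cong₂ _+_ (cong (λ c → if c then 0ℚ else 0ℚ ^ℚ m) 0∉A) (sumℚ-map-upTo (suc L′) (levelTerm m)) ⟩
      0ℚ ^ℚ m + (levelTerm m 0 + ∑ L′ (λ l → levelTerm m (suc l)))
        ≡⟨ cong (0ℚ ^ℚ m +_) (cong₂ _+_ levelTerm-0≡0 (∑-cong L′ (λ l _ → levelTerm≡ m (suc l) (inj₂ (s≤s z≤n))))) ⟩
      0ℚ ^ℚ m + (0ℚ + ∑ L′ (λ l → (β ^ℚ suc l) ^ℚ suc m * powerSum m (suc l)))
        ≡⟨ cong₂ _+_ (sym (levelTerm-0 m)) (ℚₚ.+-identityˡ _) ⟩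
      levelSum (suc L′) m
        ∎
      where
      levelTerm-0≡0 : levelTerm m 0 ≡ 0ℚ
      levelTerm-0≡0 = cong (λ c → 1ℚ ⁻¹ * ([ c ∧ (c ∨ true) ]· ((ℕ→ℚ 0 ÷₀ 1ℚ) ^ℚ m) + 0ℚ)) 0∉A

  -- The limit moments u

  shiftedTail : ℕ → (ℕ → ℚ) → ℚ
  shiftedTail m v = ∑ m (λ i → ℕ→ℚ (m C suc i) * (γ (suc i) * v (m ∸ suc i)))

  shifted≡N*v+shiftedTail : ∀ m v → shifted m v ≡ ℕ→ℚ N * v m + shiftedTail m v
  shifted≡N*v+shiftedTail m v = cong (_+ shiftedTail m v) (trans (ℚₚ.*-identityˡ _) (cong (_* v m) γ0≡N))

  m∸[1+i]<m : ∀ {m i} → i ℕ.< m → m ∸ suc i ℕ.< m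
  m∸[1+i]<m {m} {i} i<m = ℕₚ.∸-monoʳ-< {m} {suc i} {0} (s≤s z≤n) i<m

  C*γ*-mono-≤ : ∀ m j → x ≤ y → ℕ→ℚ (m C j) * (γ j * x) ≤ ℕ→ℚ (m C j) * (γ j * y)
  C*γ*-mono-≤ m j x≤y = *-monoˡ-≤-nonNeg (ℕ→ℚ-nonNeg (m C j)) (*-monoˡ-≤-nonNeg (γ-nonNeg j) x≤y)

  C*γ*-nonNeg : ∀ m j → 0ℚ ≤ x → 0ℚ ≤ ℕ→ℚ (m C j) * (γ j * x)
  C*γ*-nonNeg m j 0≤x = nonNeg*nonNeg⇒nonNeg (ℕ→ℚ-nonNeg (m C j)) (nonNeg*nonNeg⇒nonNeg (γ-nonNeg j) 0≤x)

  shifted-mono-≤ : ∀ m {v w} → (∀ k → v k ≤ w k) → shifted m v ≤ shifted m w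
  shifted-mono-≤ m v≤w = ∑-mono-≤ (suc m) (λ j _ → C*γ*-mono-≤ m j (v≤w (m ∸ j)))

  shifted-nonNeg : ∀ m {v} → (∀ k → 0ℚ ≤ v k) → 0ℚ ≤ shifted m v
  shifted-nonNeg m 0≤v = ∑-nonNeg (suc m) (λ j _ → C*γ*-nonNeg m j (0≤v (m ∸ j)))

  shiftedTail-mono-≤ : ∀ m {v w} → (∀ k → k ℕ.< m → v k ≤ w k) → shiftedTail m v ≤ shiftedTail m w
  shiftedTail-mono-≤ m v≤w = ∑-mono-≤ m (λ i i<m → C*γ*-mono-≤ m (suc i) (v≤w _ (m∸[1+i]<m i<m)))

  shiftedTail-nonNeg : ∀ m {v} → (∀ k → k ℕ.< m → 0ℚ ≤ v k) → 0ℚ ≤ shiftedTail m v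
  shiftedTail-nonNeg m 0≤v = ∑-nonNeg m (λ i i<m → C*γ*-nonNeg m (suc i) (0≤v _ (m∸[1+i]<m i<m)))

  -- shifted m (λ _ → r) = r Σ_{a ∈ A} (a + 1)^m, and a + 1 ≤ b for every digit a.
  shifted-const≤ : ∀ m {r} → 0ℚ ≤ r → shifted m (λ _ → r) ≤ ℕ→ℚ N * bℚ ^ℚ m * r
  shifted-const≤ m {r} 0≤r = begin
    shifted m (λ _ → r)
      ≡⟨ ∑-cong (suc m) (λ j _ → solve 3 (λ c g r → c :* (g :* r) := c :* (g :* con 1ℚ) :* r) refl (ℕ→ℚ (m C j)) (γ j) r) ⟩
    ∑ (suc m) (λ j → ℕ→ℚ (m C j) * (γ j * 1ℚ) * r)
      ≡⟨ sym (*-distribʳ-∑ (suc m) r (λ j → ℕ→ℚ (m C j) * (γ j * 1ℚ))) ⟩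
    ∑ (suc m) (λ j → ℕ→ℚ (m C j) * (γ j * 1ℚ)) * r
      ≡⟨ cong (_* r) (trans (∑-cong (suc m) (λ j _ → cong (λ t → ℕ→ℚ (m C j) * (γ j * t)) (sym (1^ℚn≡1 j))))
                            (∑-binomial-γ 1ℚ m)) ⟩
    ∑A (λ a → (ℕ→ℚ a * 1ℚ + 1ℚ) ^ℚ m) * r
      ≤⟨ *-monoʳ-≤-nonNeg 0≤r (∑A-mono-≤ (λ a a<b → ^ℚ-mono-≤ m (a+1-nonNeg a) (a+1≤b a a<b))) ⟩
    ∑A (λ _ → bℚ ^ℚ m) * r
      ≡⟨ cong (_* r) (∑A-const (bℚ ^ℚ m)) ⟩
    ℕ→ℚ N * bℚ ^ℚ m * r
      ∎
    where
    open ℚₚ.≤-Reasoning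
    a+1≡ : ∀ a → ℕ→ℚ a * 1ℚ + 1ℚ ≡ ℕ→ℚ (suc a)
    a+1≡ a = trans (cong (_+ 1ℚ) (ℚₚ.*-identityʳ (ℕ→ℚ a))) (trans (ℚₚ.+-comm (ℕ→ℚ a) 1ℚ) (sym (ℕ→ℚ-suc a)))
    a+1-nonNeg : ∀ a → 0ℚ ≤ ℕ→ℚ a * 1ℚ + 1ℚ
    a+1-nonNeg a = subst (0ℚ ≤_) (sym (a+1≡ a)) (ℕ→ℚ-nonNeg (suc a))
    a+1≤b : ∀ a → a ℕ.< b → ℕ→ℚ a * 1ℚ + 1ℚ ≤ bℚ
    a+1≤b a a<b = subst (_≤ bℚ) (sym (a+1≡ a)) (ℕ→ℚ-mono-≤ a<b)

  shiftedTail-const≤ : ∀ m {r} → 0ℚ ≤ r → shiftedTail m (λ _ → r) ≤ (ℕ→ℚ N * bℚ ^ℚ m - ℕ→ℚ N) * r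
  shiftedTail-const≤ m {r} 0≤r = begin
    shiftedTail m (λ _ → r)
      ≡⟨ x+y≡z⇒x≡z-y (trans (ℚₚ.+-comm (shiftedTail m (λ _ → r)) (ℕ→ℚ N * r)) (sym (shifted≡N*v+shiftedTail m (λ _ → r)))) ⟩
    shifted m (λ _ → r) - ℕ→ℚ N * r
      ≤⟨ ℚₚ.+-monoˡ-≤ (- (ℕ→ℚ N * r)) (shifted-const≤ m 0≤r) ⟩
    ℕ→ℚ N * bℚ ^ℚ m * r - ℕ→ℚ N * r
      ≡⟨ solve 3 (λ n p r → n :* p :* r :+ (:- (n :* r)) := (n :* p :+ (:- n)) :* r) refl (ℕ→ℚ N) (bℚ ^ℚ m) r ⟩
    (ℕ→ℚ N * bℚ ^ℚ m - ℕ→ℚ N) * r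
      ∎
    where open ℚₚ.≤-Reasoning

  -- The limit u of the moments solves u m = 0^m + β^{m+1} (shifted m u); the j = 0 term
  -- N u m of `shifted m u` is moved to the left, leaving a recursion on smaller moments.
  uStep : ℕ → (ℕ → ℚ) → ℚ
  uStep m v = (0ℚ ^ℚ m + β ^ℚ suc m * shiftedTail m v) * (1ℚ - β ^ℚ suc m * ℕ→ℚ N) ⁻¹

  uTable : ℕ → ℕ → ℚ
  uTable zero k = 0ℚ
  uTable (suc M) k = if k ℕ.<ᵇ M then uTable M k else uStep M (uTable M)

  u : ℕ → ℚ
  u m = uStep m (uTable m)

  uTable≡u : ∀ M k → k ℕ.< M → uTable M k ≡ u k
  uTable≡u (suc M) k (s≤s k≤M) with k ℕ.<ᵇ M in k<ᵇM
  ... | true = uTable≡u M k (ℕₚ.<ᵇ⇒< k M (subst T (sym k<ᵇM) _))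
  ... | false = cong u (sym (ℕₚ.≤∧≮⇒≡ k≤M (λ k<M → subst T k<ᵇM (ℕₚ.<⇒<ᵇ k<M))))

  u-unfold : ∀ m → u m ≡ uStep m u
  u-unfold m = cong (λ t → (0ℚ ^ℚ m + β ^ℚ suc m * t) * (1ℚ - β ^ℚ suc m * ℕ→ℚ N) ⁻¹)
    (∑-cong m (λ i i<m → cong (λ t → ℕ→ℚ (m C suc i) * (γ (suc i) * t)) (uTable≡u m _ (m∸[1+i]<m i<m))))

  module _ (N<b : N ℕ.< b) where

    ρ : ℚ
    ρ = β * ℕ→ℚ N

    0≤β : 0ℚ ≤ β
    0≤β = ℚₚ.<⇒≤ (⁻¹-pos 0<bℚ)

    0≤ρ : 0ℚ ≤ ρ
    0≤ρ = nonNeg*nonNeg⇒nonNeg 0≤β (ℕ→ℚ-nonNeg N)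

    ρ<1 : ρ < 1ℚ
    ρ<1 = subst (ρ <_) (⁻¹-inverseˡ bℚ≢0) (*-monoʳ-<-pos (⁻¹-pos 0<bℚ) (ℕ→ℚ-mono-< N<b))

    β^[1+m]*bℚ^m≡β : ∀ m → β ^ℚ suc m * bℚ ^ℚ m ≡ β
    β^[1+m]*bℚ^m≡β m = trans (ℚₚ.*-assoc β _ _) (trans (cong (β *_) (β^n*bℚ^n≡1 m)) (ℚₚ.*-identityʳ β))

    β≤1 : β ≤ 1ℚ
    β≤1 = subst₂ _≤_ (ℚₚ.*-identityʳ β) (⁻¹-inverseˡ bℚ≢0) (*-monoˡ-≤-nonNeg 0≤β 1≤bℚ)

    β^[1+m]N≤ρ : ∀ m → β ^ℚ suc m * ℕ→ℚ N ≤ ρ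
    β^[1+m]N≤ρ m = *-monoʳ-≤-nonNeg (ℕ→ℚ-nonNeg N)
      (subst (β ^ℚ suc m ≤_) (ℚₚ.*-identityʳ β) (*-monoˡ-≤-nonNeg 0≤β (^ℚ-≤1 m 0≤β β≤1)))

    N<bℚ^[1+m] : ∀ m → ℕ→ℚ N < bℚ ^ℚ suc m
    N<bℚ^[1+m] m = ℚₚ.<-≤-trans (ℕ→ℚ-mono-< N<b) (subst (_≤ bℚ ^ℚ suc m) (ℚₚ.*-identityʳ bℚ)
      (*-monoˡ-≤-nonNeg (ℚₚ.<⇒≤ 0<bℚ) (1≤^ℚ m 1≤bℚ)))

    0<denominator : ∀ m → 0ℚ < 1ℚ - β ^ℚ suc m * ℕ→ℚ N
    0<denominator m = p<q⇒0<q-p (ℚₚ.≤-<-trans (β^[1+m]N≤ρ m) ρ<1)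

    u*denominator : ∀ m → u m * (1ℚ - β ^ℚ suc m * ℕ→ℚ N) ≡ 0ℚ ^ℚ m + β ^ℚ suc m * shiftedTail m u
    u*denominator m = begin
      u m * d                      ≡⟨ cong (_* d) (u-unfold m) ⟩
      t * d ⁻¹ * d                 ≡⟨ ℚₚ.*-assoc t (d ⁻¹) d ⟩
      t * (d ⁻¹ * d)               ≡⟨ cong (t *_) (⁻¹-inverseˡ (ℚₚ.<⇒≢ (0<denominator m) ∘ sym)) ⟩
      t * 1ℚ                       ≡⟨ ℚₚ.*-identityʳ t ⟩
      t                            ∎
      where
      open ≡-Reasoning
      d : ℚ
      d = 1ℚ - β ^ℚ suc m * ℕ→ℚ N
      t : ℚ
      t = 0ℚ ^ℚ m + β ^ℚ suc m * shiftedTail m u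

    u-fixpoint : ∀ m → u m ≡ 0ℚ ^ℚ m + β ^ℚ suc m * shifted m u
    u-fixpoint m = sym (begin
      0ℚ ^ℚ m + β ^ℚ suc m * shifted m u
        ≡⟨ cong (λ t → 0ℚ ^ℚ m + β ^ℚ suc m * t) (shifted≡N*v+shiftedTail m u) ⟩
      0ℚ ^ℚ m + β ^ℚ suc m * (ℕ→ℚ N * u m + shiftedTail m u)
        ≡⟨ solve 5 (λ z p n w s → z :+ p :* (n :* w :+ s) := (z :+ p :* s) :+ p :* n :* w) refl
             (0ℚ ^ℚ m) (β ^ℚ suc m) (ℕ→ℚ N) (u m) (shiftedTail m u) ⟩
      0ℚ ^ℚ m + β ^ℚ suc m * shiftedTail m u + β ^ℚ suc m * ℕ→ℚ N * u m
        ≡⟨ cong (_+ β ^ℚ suc m * ℕ→ℚ N * u m) (sym (u*denominator m)) ⟩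
      u m * (1ℚ - β ^ℚ suc m * ℕ→ℚ N) + β ^ℚ suc m * ℕ→ℚ N * u m
        ≡⟨ solve 3 (λ w p n → w :* (con 1ℚ :+ (:- (p :* n))) :+ p :* n :* w := w) refl (u m) (β ^ℚ suc m) (ℕ→ℚ N) ⟩
      u m
        ∎)
      where open ≡-Reasoning

    0<u0 : 0ℚ < u 0
    0<u0 = subst (0ℚ <_) (sym u0≡) (⁻¹-pos (0<denominator 0))
      where
      u0≡ : u 0 ≡ (1ℚ - β ^ℚ 1 * ℕ→ℚ N) ⁻¹
      u0≡ = trans (cong (λ t → (1ℚ + t) * (1ℚ - β ^ℚ 1 * ℕ→ℚ N) ⁻¹) (ℚₚ.*-zeroʳ (β ^ℚ 1)))
                  (trans (cong (_* (1ℚ - β ^ℚ 1 * ℕ→ℚ N) ⁻¹) (ℚₚ.+-identityʳ 1ℚ)) (ℚₚ.*-identityˡ _))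

    -- u m ≤ u 0 since, by shifted-const≤, the weights in the recursion for u m sum to at most ρ < 1.
    u-bounds : ∀ m → 0ℚ ≤ u m × u m ≤ u 0
    u-bounds = <-rec (λ m → 0ℚ ≤ u m × u m ≤ u 0) bound
      where
      bound : ∀ m → (∀ {k} → k ℕ.< m → 0ℚ ≤ u k × u k ≤ u 0) → 0ℚ ≤ u m × u m ≤ u 0
      bound zero _ = ℚₚ.<⇒≤ 0<u0 , ℚₚ.≤-refl
      bound (suc m′) ih = 0≤u , u≤u0
        where
        m : ℕ
        m = suc m′
        d : ℚ
        d = 1ℚ - β ^ℚ suc m * ℕ→ℚ N
        u*d≡ : u m * d ≡ β ^ℚ suc m * shiftedTail m u
        u*d≡ = trans (u*denominator m) (trans (cong (_+ β ^ℚ suc m * shiftedTail m u) (0^ℚ[1+n]≡0 m′)) (ℚₚ.+-identityˡ _))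
        0≤β^[1+m] : 0ℚ ≤ β ^ℚ suc m
        0≤β^[1+m] = ^ℚ-nonNeg (suc m) 0≤β
        0≤u : 0ℚ ≤ u m
        0≤u = *-cancelʳ-≤-pos (0<denominator m) (subst₂ _≤_ (sym (ℚₚ.*-zeroˡ d)) (sym u*d≡)
          (nonNeg*nonNeg⇒nonNeg 0≤β^[1+m] (shiftedTail-nonNeg m (λ k k<m → proj₁ (ih k<m)))))
        tail≤ : shiftedTail m u ≤ (ℕ→ℚ N * bℚ ^ℚ m - ℕ→ℚ N) * u 0
        tail≤ = ℚₚ.≤-trans (shiftedTail-mono-≤ m (λ k k<m → proj₂ (ih k<m))) (shiftedTail-const≤ m (ℚₚ.<⇒≤ 0<u0))
        u≤u0 : u m ≤ u 0
        u≤u0 = *-cancelʳ-≤-pos (0<denominator m) (begin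
          u m * d
            ≡⟨ u*d≡ ⟩
          β ^ℚ suc m * shiftedTail m u
            ≤⟨ *-monoˡ-≤-nonNeg 0≤β^[1+m] tail≤ ⟩
          β ^ℚ suc m * ((ℕ→ℚ N * bℚ ^ℚ m - ℕ→ℚ N) * u 0)
            ≡⟨ solve 4 (λ p n c w → p :* ((n :* c :+ (:- n)) :* w) := (p :* c :* n :+ (:- (p :* n))) :* w) refl
                 (β ^ℚ suc m) (ℕ→ℚ N) (bℚ ^ℚ m) (u 0) ⟩
          (β ^ℚ suc m * bℚ ^ℚ m * ℕ→ℚ N - β ^ℚ suc m * ℕ→ℚ N) * u 0
            ≡⟨ cong (λ t → (t * ℕ→ℚ N - β ^ℚ suc m * ℕ→ℚ N) * u 0) (β^[1+m]*bℚ^m≡β m) ⟩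
          (ρ - β ^ℚ suc m * ℕ→ℚ N) * u 0
            ≤⟨ *-monoʳ-≤-nonNeg (ℚₚ.<⇒≤ 0<u0) (ℚₚ.+-monoˡ-≤ (- (β ^ℚ suc m * ℕ→ℚ N)) (ℚₚ.<⇒≤ ρ<1)) ⟩
          d * u 0
            ≡⟨ ℚₚ.*-comm d (u 0) ⟩
          u 0 * d
            ∎)
          where open ℚₚ.≤-Reasoning

    shifted-distrib-- : ∀ m v w → shifted m (λ k → v k - w k) ≡ shifted m v - shifted m w
    shifted-distrib-- m v w = trans (∑-cong (suc m) (λ j _ →
      solve 4 (λ c g x y → c :* (g :* (x :+ (:- y))) := c :* (g :* x) :+ (:- (c :* (g :* y)))) refl
        (ℕ→ℚ (m C j)) (γ j) (v (m ∸ j)) (w (m ∸ j))))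
      (∑-distrib-- (suc m) (λ j → ℕ→ℚ (m C j) * (γ j * v (m ∸ j))) (λ j → ℕ→ℚ (m C j) * (γ j * w (m ∸ j))))

    error-suc : ∀ L m → u m - levelSum (suc L) m ≡ β ^ℚ suc m * shifted m (λ k → u k - levelSum L k)
    error-suc L m = begin
      u m - levelSum (suc L) m
        ≡⟨ cong₂ _-_ (u-fixpoint m) (levelSum-suc L m) ⟩
      (0ℚ ^ℚ m + β ^ℚ suc m * shifted m u) - (0ℚ ^ℚ m + β ^ℚ suc m * shifted m (λ k → levelSum L k))
        ≡⟨ solve 4 (λ z p s t → (z :+ p :* s) :+ (:- (z :+ p :* t)) := p :* (s :+ (:- t))) refl
             (0ℚ ^ℚ m) (β ^ℚ suc m) (shifted m u) (shifted m (λ k → levelSum L k)) ⟩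
      β ^ℚ suc m * (shifted m u - shifted m (λ k → levelSum L k))
        ≡⟨ cong (β ^ℚ suc m *_) (sym (shifted-distrib-- m u (λ k → levelSum L k))) ⟩
      β ^ℚ suc m * shifted m (λ k → u k - levelSum L k)
        ∎
      where open ≡-Reasoning

    error-bounds : ∀ L m → 0ℚ ≤ u m - levelSum L m × u m - levelSum L m ≤ ρ ^ℚ L * u 0
    error-bounds zero m = subst (0ℚ ≤_) (sym u-0≡u) (proj₁ (u-bounds m)) ,
                          subst₂ _≤_ (sym u-0≡u) (sym (ℚₚ.*-identityˡ (u 0))) (proj₂ (u-bounds m))
      where
      u-0≡u : u m - 0ℚ ≡ u m
      u-0≡u = solve 1 (λ x → x :+ (:- con 0ℚ) := x) refl (u m)
    error-bounds (suc L) m =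
      subst (0ℚ ≤_) (sym (error-suc L m))
        (nonNeg*nonNeg⇒nonNeg 0≤β^[1+m] (shifted-nonNeg m (λ k → proj₁ (error-bounds L k)))) ,
      (begin
        u m - levelSum (suc L) m
          ≡⟨ error-suc L m ⟩
        β ^ℚ suc m * shifted m (λ k → u k - levelSum L k)
          ≤⟨ *-monoˡ-≤-nonNeg 0≤β^[1+m] (shifted-mono-≤ m (λ k → proj₂ (error-bounds L k))) ⟩
        β ^ℚ suc m * shifted m (λ _ → ρ ^ℚ L * u 0)
          ≤⟨ *-monoˡ-≤-nonNeg 0≤β^[1+m] (shifted-const≤ m (nonNeg*nonNeg⇒nonNeg (^ℚ-nonNeg L 0≤ρ) (ℚₚ.<⇒≤ 0<u0))) ⟩
        β ^ℚ suc m * (ℕ→ℚ N * bℚ ^ℚ m * (ρ ^ℚ L * u 0))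
          ≡⟨ solve 4 (λ p n c r → p :* (n :* c :* r) := p :* c :* n :* r) refl (β ^ℚ suc m) (ℕ→ℚ N) (bℚ ^ℚ m) (ρ ^ℚ L * u 0) ⟩
        β ^ℚ suc m * bℚ ^ℚ m * ℕ→ℚ N * (ρ ^ℚ L * u 0)
          ≡⟨ cong (λ t → t * ℕ→ℚ N * (ρ ^ℚ L * u 0)) (β^[1+m]*bℚ^m≡β m) ⟩
        ρ * (ρ ^ℚ L * u 0)
          ≡⟨ sym (ℚₚ.*-assoc ρ (ρ ^ℚ L) (u 0)) ⟩
        ρ ^ℚ suc L * u 0
          ∎)
      where
      open ℚₚ.≤-Reasoning
      0≤β^[1+m] : 0ℚ ≤ β ^ℚ suc m
      0≤β^[1+m] = ^ℚ-nonNeg (suc m) 0≤β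

    u-converges : ∀ m → ConvergesTo (uPartial m) (u m)
    u-converges m ε 0<ε = suc L₀ , close
      where
      L₀ : ℕ
      L₀ = proj₁ (x^n*r→0 0≤ρ ρ<1 (ℚₚ.<⇒≤ 0<u0) ε 0<ε)
      close : ∀ L → suc L₀ ℕ.≤ L → ℚ.∣ uPartial m L - u m ∣ < ε
      close L 1+L₀≤L = subst (_< ε) (sym ∣uPartial-u∣≡) (ℚₚ.≤-<-trans (proj₂ (error-bounds L m))
        (proj₂ (x^n*r→0 0≤ρ ρ<1 (ℚₚ.<⇒≤ 0<u0) ε 0<ε) L (ℕₚ.<⇒≤ 1+L₀≤L)))
        where
        open ≡-Reasoning
        ∣uPartial-u∣≡ : ℚ.∣ uPartial m L - u m ∣ ≡ u m - levelSum L m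
        ∣uPartial-u∣≡ = begin
          ℚ.∣ uPartial m L - u m ∣           ≡⟨ cong (λ t → ℚ.∣ t - u m ∣) (uPartial≡levelSum m L (ℕₚ.≤-trans (s≤s z≤n) 1+L₀≤L)) ⟩
          ℚ.∣ levelSum L m - u m ∣           ≡⟨ cong ℚ.∣_∣ (solve 2 (λ s w → s :+ (:- w) := :- (w :+ (:- s))) refl (levelSum L m) (u m)) ⟩
          ℚ.∣ - (u m - levelSum L m) ∣       ≡⟨ ℚₚ.∣-p∣≡∣p∣ (u m - levelSum L m) ⟩
          ℚ.∣ u m - levelSum L m ∣           ≡⟨ ℚₚ.0≤p⇒∣p∣≡p (proj₁ (error-bounds L m)) ⟩
          u m - levelSum L m                 ∎

    -- The normalised moments λ

    c : ℚ
    c = ℕ→ℚ (b ∸ 1) ÷₀ ℕ→ℚ f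

    lam-suc : ∀ k → lam u (suc k) ≡ ℕ→ℚ (suc k) * c ^ℚ k * (u k * u 0 ⁻¹)
    lam-suc k = cong (ℕ→ℚ (suc k) * c ^ℚ k *_) (x÷₀y≡x*y⁻¹ (u k) (u 0))

    lam-1 : lam u 1 ≡ 1ℚ
    lam-1 = trans (lam-suc 0) (trans (ℚₚ.*-identityˡ _) (⁻¹-inverseʳ (ℚₚ.<⇒≢ 0<u0 ∘ sym)))

    u*[bℚ^[2+M]-N]≡shiftedTail : ∀ M → u (suc M) * (bℚ ^ℚ suc (suc M) - ℕ→ℚ N) ≡ shiftedTail (suc M) u
    u*[bℚ^[2+M]-N]≡shiftedTail M = begin
      u m * (bℚ ^ℚ suc m - ℕ→ℚ N)
        ≡⟨ cong (u m *_) (sym denominator*bℚ^[1+m]) ⟩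
      u m * (d * bℚ ^ℚ suc m)
        ≡⟨ sym (ℚₚ.*-assoc (u m) d (bℚ ^ℚ suc m)) ⟩
      u m * d * bℚ ^ℚ suc m
        ≡⟨ cong (_* bℚ ^ℚ suc m) (trans (u*denominator m) (cong (_+ β ^ℚ suc m * shiftedTail m u) (0^ℚ[1+n]≡0 M))) ⟩
      (0ℚ + β ^ℚ suc m * shiftedTail m u) * bℚ ^ℚ suc m
        ≡⟨ solve 3 (λ p s q → (con 0ℚ :+ p :* s) :* q := s :* (p :* q)) refl (β ^ℚ suc m) (shiftedTail m u) (bℚ ^ℚ suc m) ⟩
      shiftedTail m u * (β ^ℚ suc m * bℚ ^ℚ suc m)
        ≡⟨ trans (cong (shiftedTail m u *_) (β^n*bℚ^n≡1 (suc m))) (ℚₚ.*-identityʳ _) ⟩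
      shiftedTail m u
        ∎
      where
      open ≡-Reasoning
      m : ℕ
      m = suc M
      d : ℚ
      d = 1ℚ - β ^ℚ suc m * ℕ→ℚ N
      denominator*bℚ^[1+m] : d * bℚ ^ℚ suc m ≡ bℚ ^ℚ suc m - ℕ→ℚ N
      denominator*bℚ^[1+m] = begin
        (1ℚ - β ^ℚ suc m * ℕ→ℚ N) * bℚ ^ℚ suc m
          ≡⟨ solve 3 (λ p n q → (con 1ℚ :+ (:- (p :* n))) :* q := q :+ (:- (p :* q :* n))) refl (β ^ℚ suc m) (ℕ→ℚ N) (bℚ ^ℚ suc m) ⟩
        bℚ ^ℚ suc m - β ^ℚ suc m * bℚ ^ℚ suc m * ℕ→ℚ N
          ≡⟨ cong (λ t → bℚ ^ℚ suc m - t * ℕ→ℚ N) (β^n*bℚ^n≡1 (suc m)) ⟩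
        bℚ ^ℚ suc m - 1ℚ * ℕ→ℚ N
          ≡⟨ cong (_-_ (bℚ ^ℚ suc m)) (ℚₚ.*-identityˡ (ℕ→ℚ N)) ⟩
        bℚ ^ℚ suc m - ℕ→ℚ N
          ∎

    module _ (1≤f : 1 ℕ.≤ f) where

      0<f : 0ℚ < ℕ→ℚ f
      0<f = ℕ→ℚ-mono-< {0} {f} 1≤f

      f≢0 : ℕ→ℚ f ≢ 0ℚ
      f≢0 f≡0 = ℚₚ.<⇒≢ 0<f (sym f≡0)

      τ : ℕ → ℕ → ℚ
      τ m j = ℕ→ℚ (m C j) * (γ j * c ^ℚ j)

      rhs≡∑τ*lam : ∀ M → rhs u (suc M) ≡ ∑ M (λ i → τ (suc M) (suc i) * lam u (M ∸ i))
      rhs≡∑τ*lam M = trans (sumℚ-map-upTo (suc M) (λ j → if j ℕ.<ᵇ 1 then 0ℚ else summand j))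
        (trans (ℚₚ.+-identityˡ _) (∑-cong M (λ i _ → cong (_* lam u (M ∸ i))
          (trans (ℚₚ.*-assoc (ℕ→ℚ (suc M C suc i)) (γ (suc i) ÷₀ (ℕ→ℚ f ^ℚ suc i)) (ℕ→ℚ (b ∸ 1) ^ℚ suc i))
                 (cong (ℕ→ℚ (suc M C suc i) *_) (coefficient (suc i)))))))
        where
        summand : ℕ → ℚ
        summand j = ℕ→ℚ (suc M C j) * (γ j ÷₀ (ℕ→ℚ f ^ℚ j)) * (ℕ→ℚ (b ∸ 1) ^ℚ j) * lam u (suc M ∸ j)
        coefficient : ∀ j → (γ j ÷₀ (ℕ→ℚ f ^ℚ j)) * (ℕ→ℚ (b ∸ 1) ^ℚ j) ≡ γ j * c ^ℚ j
        coefficient j = begin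
          (γ j ÷₀ (ℕ→ℚ f ^ℚ j)) * ℕ→ℚ (b ∸ 1) ^ℚ j
            ≡⟨ cong (_* ℕ→ℚ (b ∸ 1) ^ℚ j) (trans (x÷₀y≡x*y⁻¹ (γ j) (ℕ→ℚ f ^ℚ j)) (cong (γ j *_) (⁻¹-distrib-^ℚ f≢0 j))) ⟩
          γ j * ℕ→ℚ f ⁻¹ ^ℚ j * ℕ→ℚ (b ∸ 1) ^ℚ j
            ≡⟨ solve 3 (λ g x y → g :* x :* y := g :* (y :* x)) refl (γ j) (ℕ→ℚ f ⁻¹ ^ℚ j) (ℕ→ℚ (b ∸ 1) ^ℚ j) ⟩
          γ j * (ℕ→ℚ (b ∸ 1) ^ℚ j * ℕ→ℚ f ⁻¹ ^ℚ j)
            ≡⟨ cong (γ j *_) (sym (^ℚ-distrib-* (ℕ→ℚ (b ∸ 1)) (ℕ→ℚ f ⁻¹) j)) ⟩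
          γ j * (ℕ→ℚ (b ∸ 1) * ℕ→ℚ f ⁻¹) ^ℚ j
            ≡⟨ cong (λ t → γ j * t ^ℚ j) (sym (x÷₀y≡x*y⁻¹ (ℕ→ℚ (b ∸ 1)) (ℕ→ℚ f))) ⟩
          γ j * c ^ℚ j
            ∎
          where open ≡-Reasoning

      τ*lam-as-u : ∀ m {i} → i ℕ.< m → τ (suc m) (suc i) * lam u (m ∸ i) ≡
                   ℕ→ℚ (suc m) * c ^ℚ m * u 0 ⁻¹ * (ℕ→ℚ (m C suc i) * (γ (suc i) * u (m ∸ suc i)))
      τ*lam-as-u m {i} i<m = begin
        τ (suc m) (suc i) * lam u (m ∸ i)
          ≡⟨ cong (λ n → τ (suc m) (suc i) * lam u n) m∸i≡1+k ⟩
        τ (suc m) (suc i) * lam u (suc k)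
          ≡⟨ cong (τ (suc m) (suc i) *_) (lam-suc k) ⟩
        ℕ→ℚ (suc m C suc i) * (γ (suc i) * c ^ℚ suc i) * (ℕ→ℚ (suc k) * c ^ℚ k * (u k * u 0 ⁻¹))
          ≡⟨ solve 7 (λ C g p s q w v → C :* (g :* p) :* (s :* q :* (w :* v)) := (s :* C) :* (p :* q) :* v :* (g :* w)) refl
               (ℕ→ℚ (suc m C suc i)) (γ (suc i)) (c ^ℚ suc i) (ℕ→ℚ (suc k)) (c ^ℚ k) (u k) (u 0 ⁻¹) ⟩
        ℕ→ℚ (suc k) * ℕ→ℚ (suc m C suc i) * (c ^ℚ suc i * c ^ℚ k) * u 0 ⁻¹ * (γ (suc i) * u k)
          ≡⟨ cong₂ (λ x y → x * y * u 0 ⁻¹ * (γ (suc i) * u k)) absorption powers ⟩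
        ℕ→ℚ (suc m) * ℕ→ℚ (m C suc i) * c ^ℚ m * u 0 ⁻¹ * (γ (suc i) * u k)
          ≡⟨ solve 5 (λ a C p v r → a :* C :* p :* v :* r := a :* p :* v :* (C :* r)) refl
               (ℕ→ℚ (suc m)) (ℕ→ℚ (m C suc i)) (c ^ℚ m) (u 0 ⁻¹) (γ (suc i) * u k) ⟩
        ℕ→ℚ (suc m) * c ^ℚ m * u 0 ⁻¹ * (ℕ→ℚ (m C suc i) * (γ (suc i) * u k))
          ∎
        where
        open ≡-Reasoning
        k : ℕ
        k = m ∸ suc i
        m∸i≡1+k : m ∸ i ≡ suc k
        m∸i≡1+k = ℕₚ.+-∸-assoc 1 i<m
        absorption : ℕ→ℚ (suc k) * ℕ→ℚ (suc m C suc i) ≡ ℕ→ℚ (suc m) * ℕ→ℚ (m C suc i)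
        absorption = begin
          ℕ→ℚ (suc k) * ℕ→ℚ (suc m C suc i)    ≡⟨ sym (ℕ→ℚ-homo-* (suc k) (suc m C suc i)) ⟩
          ℕ→ℚ (suc k ℕ.* (suc m C suc i))      ≡⟨ cong (λ n → ℕ→ℚ (n ℕ.* (suc m C suc i))) (sym m∸i≡1+k) ⟩
          ℕ→ℚ ((m ∸ i) ℕ.* (suc m C suc i))    ≡⟨ cong ℕ→ℚ ([1+m∸j]*[1+m]Cj≡[1+m]*mCj i<m) ⟩
          ℕ→ℚ (suc m ℕ.* (m C suc i))          ≡⟨ ℕ→ℚ-homo-* (suc m) (m C suc i) ⟩
          ℕ→ℚ (suc m) * ℕ→ℚ (m C suc i)        ∎
        powers : c ^ℚ suc i * c ^ℚ k ≡ c ^ℚ m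
        powers = trans (sym (^ℚ-homo-* c (suc i) k)) (cong (c ^ℚ_) (ℕₚ.m+[n∸m]≡n i<m))

      lam-recurrence-τ : ∀ M → (bℚ ^ℚ suc (suc M) - ℕ→ℚ N) * lam u (suc (suc M)) ≡
                              ∑ (suc M) (λ i → τ (suc (suc M)) (suc i) * lam u (suc M ∸ i))
      lam-recurrence-τ M = begin
        (bℚ ^ℚ suc m - ℕ→ℚ N) * lam u (suc m)
          ≡⟨ cong ((bℚ ^ℚ suc m - ℕ→ℚ N) *_) (lam-suc m) ⟩
        (bℚ ^ℚ suc m - ℕ→ℚ N) * (ℕ→ℚ (suc m) * c ^ℚ m * (u m * u 0 ⁻¹))
          ≡⟨ solve 5 (λ d a p w v → d :* (a :* p :* (w :* v)) := (a :* p :* v) :* (w :* d)) refl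
               (bℚ ^ℚ suc m - ℕ→ℚ N) (ℕ→ℚ (suc m)) (c ^ℚ m) (u m) (u 0 ⁻¹) ⟩
        K * (u m * (bℚ ^ℚ suc m - ℕ→ℚ N))
          ≡⟨ cong (K *_) (u*[bℚ^[2+M]-N]≡shiftedTail M) ⟩
        K * shiftedTail m u
          ≡⟨ *-distribˡ-∑ m K (λ i → ℕ→ℚ (m C suc i) * (γ (suc i) * u (m ∸ suc i))) ⟩
        ∑ m (λ i → K * (ℕ→ℚ (m C suc i) * (γ (suc i) * u (m ∸ suc i))))
          ≡⟨ ∑-cong m (λ i i<m → sym (τ*lam-as-u m i<m)) ⟩
        ∑ m (λ i → τ (suc m) (suc i) * lam u (m ∸ i))
          ∎
        where
        open ≡-Reasoning
        m : ℕ
        m = suc M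
        K : ℚ
        K = ℕ→ℚ (suc m) * c ^ℚ m * u 0 ⁻¹

      lam-recurrence : ∀ M → (ℕ→ℚ (b ℕ.^ suc (suc M)) - ℕ→ℚ N) * lam u (suc (suc M)) ≡ rhs u (suc (suc M))
      lam-recurrence M = trans (cong (λ x → (x - ℕ→ℚ N) * lam u (suc (suc M))) (ℕ→ℚ-homo-^ b (suc (suc M))))
        (trans (lam-recurrence-τ M) (sym (rhs≡∑τ*lam (suc M))))

      f∈A : inAℕ f ≡ true
      f∈A with f≡0⊎f∈A
      ... | inj₁ f≡0 = ⊥-elim (ℕₚ.<-irrefl (sym f≡0) 1≤f)
      ... | inj₂ f∈A = f∈A

      f≤b-1 : f ℕ.≤ b ∸ 1
      f≤b-1 = ℕₚ.<⇒≤pred (inAℕ-<b f∈A)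

      f*c≡b-1 : ℕ→ℚ f * c ≡ ℕ→ℚ (b ∸ 1)
      f*c≡b-1 = begin
        ℕ→ℚ f * (ℕ→ℚ (b ∸ 1) ÷₀ ℕ→ℚ f)      ≡⟨ cong (ℕ→ℚ f *_) (x÷₀y≡x*y⁻¹ (ℕ→ℚ (b ∸ 1)) (ℕ→ℚ f)) ⟩
        ℕ→ℚ f * (ℕ→ℚ (b ∸ 1) * ℕ→ℚ f ⁻¹)    ≡⟨ solve 3 (λ a x y → a :* (x :* y) := x :* (a :* y)) refl (ℕ→ℚ f) (ℕ→ℚ (b ∸ 1)) (ℕ→ℚ f ⁻¹) ⟩
        ℕ→ℚ (b ∸ 1) * (ℕ→ℚ f * ℕ→ℚ f ⁻¹)    ≡⟨ cong (ℕ→ℚ (b ∸ 1) *_) (⁻¹-inverseʳ f≢0) ⟩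
        ℕ→ℚ (b ∸ 1) * 1ℚ                     ≡⟨ ℚₚ.*-identityʳ _ ⟩
        ℕ→ℚ (b ∸ 1)                          ∎
        where open ≡-Reasoning

      f<b-1⇒1<c : f ℕ.< b ∸ 1 → 1ℚ < c
      f<b-1⇒1<c f<b-1 = *-cancelʳ-<-nonNeg (ℚₚ.<⇒≤ 0<f)
        (subst₂ _<_ (sym (ℚₚ.*-identityˡ (ℕ→ℚ f))) (trans (sym f*c≡b-1) (ℚₚ.*-comm (ℕ→ℚ f) c)) (ℕ→ℚ-mono-< f<b-1))

      1≤c : 1ℚ ≤ c
      1≤c = *-cancelʳ-≤-pos 0<f
        (subst₂ _≤_ (sym (ℚₚ.*-identityˡ (ℕ→ℚ f))) (trans (sym f*c≡b-1) (ℚₚ.*-comm (ℕ→ℚ f) c)) (ℕ→ℚ-mono-≤ f≤b-1))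

      0<c : 0ℚ < c
      0<c = ℚₚ.<-≤-trans 0<1 1≤c

      b-1+1≡b : ℕ→ℚ (b ∸ 1) + 1ℚ ≡ bℚ
      b-1+1≡b = trans (sym (ℕ→ℚ-homo-+ (b ∸ 1) 1)) (cong ℕ→ℚ (ℕₚ.m∸n+n≡m (ℕₚ.<⇒≤ hb)))

      -- c rescales the digits so that the largest one, f, becomes b - 1.
      scaled : ℕ → ℚ
      scaled d = ℕ→ℚ d * c

      0≤scaled : ∀ d → 0ℚ ≤ scaled d
      0≤scaled d = nonNeg*nonNeg⇒nonNeg (ℕ→ℚ-nonNeg d) (ℚₚ.<⇒≤ 0<c)

      scaled-suc : ∀ d → scaled (suc d) ≡ scaled d + c
      scaled-suc d = trans (cong (_* c) (ℕ→ℚ-suc d)) (solve 2 (λ a c → (con 1ℚ :+ a) :* c := a :* c :+ c) refl (ℕ→ℚ d) c)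

      γ*c^j≡∑A : ∀ j → γ j * c ^ℚ j ≡ ∑A (λ a → scaled a ^ℚ j)
      γ*c^j≡∑A j = begin
        γ j * c ^ℚ j                          ≡⟨ cong (_* c ^ℚ j) (γ≡∑A j) ⟩
        ∑A (λ a → ℕ→ℚ a ^ℚ j) * c ^ℚ j        ≡⟨ *-distribʳ-∑A (c ^ℚ j) _ ⟩
        ∑A (λ a → ℕ→ℚ a ^ℚ j * c ^ℚ j)        ≡⟨ ∑-cong b (λ d _ → cong ([ inAℕ d ]·_) (sym (^ℚ-distrib-* (ℕ→ℚ d) c j))) ⟩
        ∑A (λ a → scaled a ^ℚ j)              ∎
        where open ≡-Reasoning

      τ-nonNeg : ∀ m j → 0ℚ ≤ τ m j
      τ-nonNeg m j = C*γ*-nonNeg m j (^ℚ-nonNeg j (ℚₚ.<⇒≤ 0<c))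

      G : ℕ → ℚ → ℚ
      G m y = (y + 1ℚ) ^ℚ m - y ^ℚ m

      ∑τ-inner : ∀ M → ∑ M (λ i → τ (suc M) (suc i)) ≡ ∑A (λ a → G (suc M) (scaled a)) - ℕ→ℚ N
      ∑τ-inner M = begin
        S
          ≡⟨ solve 3 (λ s a z → s := a :+ (s :+ z) :+ (:- z) :+ (:- a)) refl S (τ m 0) (τ m m) ⟩
        τ m 0 + (S + τ m m) - τ m m - τ m 0
          ≡⟨ cong (λ t → τ m 0 + t - τ m m - τ m 0) (sym (∑-init-last M (λ i → τ m (suc i)))) ⟩
        ∑ (suc m) (τ m) - τ m m - τ m 0
          ≡⟨ cong₂ (λ t z → t - z - τ m 0) (∑-binomial-γ c m) τ-m-m ⟩
        ∑A (λ a → (scaled a + 1ℚ) ^ℚ m) - ∑A (λ a → scaled a ^ℚ m) - τ m 0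
          ≡⟨ cong₂ _-_ (sym (∑A-distrib-- (λ a → (scaled a + 1ℚ) ^ℚ m) (λ a → scaled a ^ℚ m))) τ-m-0 ⟩
        ∑A (λ a → G m (scaled a)) - ℕ→ℚ N
          ∎
        where
        open ≡-Reasoning
        m : ℕ
        m = suc M
        S : ℚ
        S = ∑ M (λ i → τ m (suc i))
        τ-m-m : τ m m ≡ ∑A (λ a → scaled a ^ℚ m)
        τ-m-m = trans (cong (λ n → ℕ→ℚ n * (γ m * c ^ℚ m)) (nCn≡1 m)) (trans (ℚₚ.*-identityˡ _) (γ*c^j≡∑A m))
        τ-m-0 : τ m 0 ≡ ℕ→ℚ N
        τ-m-0 = trans (ℚₚ.*-identityˡ _) (trans (ℚₚ.*-identityʳ (γ 0)) γ0≡N)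

      ∑A≡∑[≤f] : ∀ g → ∑A g ≡ ∑ (suc f) (λ d → [ inAℕ d ]· g d)
      ∑A≡∑[≤f] g = begin
        ∑ b h                                      ≡⟨ cong (λ n → ∑ n h) (sym (ℕₚ.m+[n∸m]≡n (inAℕ-<b f∈A))) ⟩
        ∑ (suc f ℕ.+ (b ∸ suc f)) h                ≡⟨ ∑-split (suc f) (b ∸ suc f) h ⟩
        ∑ (suc f) h + ∑ (b ∸ suc f) (λ i → h (suc f ℕ.+ i))
          ≡⟨ cong (∑ (suc f) h +_) (trans (∑-cong (b ∸ suc f) (λ i _ → h[>f]≡0 i)) (∑-zero (b ∸ suc f))) ⟩
        ∑ (suc f) h + 0ℚ                           ≡⟨ ℚₚ.+-identityʳ _ ⟩
        ∑ (suc f) h                                ∎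
        where
        open ≡-Reasoning
        h : ℕ → ℚ
        h d = [ inAℕ d ]· g d
        h[>f]≡0 : ∀ i → h (suc f ℕ.+ i) ≡ 0ℚ
        h[>f]≡0 i with inAℕ (suc f ℕ.+ i) in d∈A
        ... | true = ⊥-elim (ℕₚ.<-irrefl refl (ℕₚ.<-≤-trans (ℕₚ.m≤m+n (suc f) i) (digit≤f d∈A)))
        ... | false = refl

      -- G m is increasing, and consecutive scaled digits are c ≥ 1 apart, so the sum of
      -- G m over the scaled digits telescopes to at most (c f + 1)^m = b^m.
      partialG : ℕ → ℕ → ℚ
      partialG m y = ∑ (suc y) (λ d → [ inAℕ d ]· G m (scaled d))

      Gap : ℕ → Set
      Gap y = (Σ[ z ∈ ℕ ] z ℕ.≤ y × inAℕ z ≡ false) ⊎ (1ℚ < c × Σ[ a ∈ ℕ ] 1 ℕ.≤ a × a ℕ.≤ y × inAℕ a ≡ true)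

      module _ (m′ : ℕ) where

        private
          m : ℕ
          m = suc m′

        0≤G : ∀ y → 0ℚ ≤ y → 0ℚ ≤ G m y
        0≤G y 0≤y = p≤q⇒0≤q-p (^ℚ-mono-≤ m 0≤y (p≤p+q 0≤1))

        G≤ : ∀ y → 0ℚ ≤ y → G m y ≤ (y + 1ℚ) ^ℚ m
        G≤ y 0≤y = subst (G m y ≤_) (ℚₚ.+-identityʳ _) (ℚₚ.+-monoʳ-≤ ((y + 1ℚ) ^ℚ m) (ℚₚ.neg-antimono-≤ (^ℚ-nonNeg m 0≤y)))

        0≤scaled+1 : ∀ d → 0ℚ ≤ scaled d + 1ℚ
        0≤scaled+1 d = nonNeg+nonNeg⇒nonNeg (0≤scaled d) 0≤1

        scaled+1≤scaled-suc : ∀ d → scaled d + 1ℚ ≤ scaled (suc d)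
        scaled+1≤scaled-suc d = subst (scaled d + 1ℚ ≤_) (sym (scaled-suc d)) (ℚₚ.+-monoʳ-≤ (scaled d) 1≤c)

        scaled+1<scaled-suc+1 : ∀ d → scaled d + 1ℚ < scaled (suc d) + 1ℚ
        scaled+1<scaled-suc+1 d = ℚₚ.+-monoˡ-< 1ℚ (subst (scaled d <_) (sym (scaled-suc d))
          (subst (_< scaled d + c) (ℚₚ.+-identityʳ (scaled d)) (ℚₚ.+-monoʳ-< (scaled d) 0<c)))

        telescope-step : ∀ e y → (scaled y + 1ℚ) ^ℚ m + [ e ]· G m (scaled (suc y)) ≤ (scaled (suc y) + 1ℚ) ^ℚ m
        telescope-step false y = subst (_≤ (scaled (suc y) + 1ℚ) ^ℚ m) (sym (ℚₚ.+-identityʳ _))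
          (^ℚ-mono-≤ m (0≤scaled+1 y) (ℚₚ.<⇒≤ (scaled+1<scaled-suc+1 y)))
        telescope-step true y = p≤q⇒p+[r-q]≤r (^ℚ-mono-≤ m (0≤scaled+1 y) (scaled+1≤scaled-suc y))

        partialG-suc : ∀ y → partialG m (suc y) ≡ partialG m y + [ inAℕ (suc y) ]· G m (scaled (suc y))
        partialG-suc y = ∑-init-last (suc y) (λ d → [ inAℕ d ]· G m (scaled d))

        partialG≤ : ∀ y → partialG m y ≤ (scaled y + 1ℚ) ^ℚ m
        partialG≤ zero = subst (_≤ (scaled 0 + 1ℚ) ^ℚ m) (sym (ℚₚ.+-identityʳ _))
          (ℚₚ.≤-trans ([]·x≤x (inAℕ 0) (0≤G (scaled 0) (0≤scaled 0))) (G≤ (scaled 0) (0≤scaled 0)))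
        partialG≤ (suc y) = subst (_≤ (scaled (suc y) + 1ℚ) ^ℚ m) (sym (partialG-suc y))
          (ℚₚ.≤-trans (ℚₚ.+-monoˡ-≤ ([ inAℕ (suc y) ]· G m (scaled (suc y))) (partialG≤ y)) (telescope-step (inAℕ (suc y)) y))

        from-gap : ∀ y → Gap y → partialG m (suc y) < (scaled (suc y) + 1ℚ) ^ℚ m

        partialG< : ∀ y → Gap y → partialG m y < (scaled y + 1ℚ) ^ℚ m
        partialG< zero (inj₁ (zero , _ , 0∉A)) =
          subst (_< (scaled 0 + 1ℚ) ^ℚ m) (sym (cong (λ e → [ e ]· G m (scaled 0) + 0ℚ) 0∉A))
            (ℚₚ.<-≤-trans 0<1 (1≤^ℚ m (subst (_≤ scaled 0 + 1ℚ) (ℚₚ.+-identityˡ 1ℚ) (ℚₚ.+-monoˡ-≤ 1ℚ (0≤scaled 0)))))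
        partialG< zero (inj₂ (_ , a , 1≤a , a≤0 , _)) = ⊥-elim (ℕₚ.<-irrefl refl (ℕₚ.≤-trans 1≤a a≤0))
        partialG< (suc y) (inj₁ (z , z≤1+y , z∉A)) = non-digit-at z z∉A (ℕₚ.m≤n⇒m<n∨m≡n z≤1+y)
          where
          non-digit-at : ∀ z → inAℕ z ≡ false → z ℕ.< suc y ⊎ z ≡ suc y → partialG m (suc y) < (scaled (suc y) + 1ℚ) ^ℚ m
          non-digit-at z z∉A (inj₁ z<1+y) = from-gap y (inj₁ (z , ℕₚ.<⇒≤pred z<1+y , z∉A))
          non-digit-at _ z∉A (inj₂ refl) = subst (_< (scaled (suc y) + 1ℚ) ^ℚ m)
            (sym (trans (partialG-suc y) (trans (cong (λ e → partialG m y + [ e ]· G m (scaled (suc y))) z∉A)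
                                                (ℚₚ.+-identityʳ (partialG m y)))))
            (ℚₚ.≤-<-trans (partialG≤ y) (^ℚ-mono-< m′ (0≤scaled+1 y) (scaled+1<scaled-suc+1 y)))
        partialG< (suc y) (inj₂ (1<c , a , 1≤a , a≤1+y , a∈A)) = digit-at a 1≤a a∈A (ℕₚ.m≤n⇒m<n∨m≡n a≤1+y)
          where
          scaled+1<scaled-suc : scaled y + 1ℚ < scaled (suc y)
          scaled+1<scaled-suc = subst (scaled y + 1ℚ <_) (sym (scaled-suc y)) (ℚₚ.+-monoʳ-< (scaled y) 1<c)
          digit-at : ∀ a → 1 ℕ.≤ a → inAℕ a ≡ true → a ℕ.< suc y ⊎ a ≡ suc y → partialG m (suc y) < (scaled (suc y) + 1ℚ) ^ℚ m
          digit-at a 1≤a a∈A (inj₁ a<1+y) = from-gap y (inj₂ (1<c , a , 1≤a , ℕₚ.<⇒≤pred a<1+y , a∈A))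
          digit-at _ _ a∈A (inj₂ refl) = subst (_< (scaled (suc y) + 1ℚ) ^ℚ m)
            (sym (trans (partialG-suc y) (cong (λ e → partialG m y + [ e ]· G m (scaled (suc y))) a∈A)))
            (ℚₚ.≤-<-trans (ℚₚ.+-monoˡ-≤ (G m (scaled (suc y))) (partialG≤ y))
              (p<q⇒p+[r-q]<r (^ℚ-mono-< m′ (0≤scaled+1 y) scaled+1<scaled-suc)))

        from-gap y gap = subst (_< (scaled (suc y) + 1ℚ) ^ℚ m) (sym (partialG-suc y))
          (ℚₚ.<-≤-trans (ℚₚ.+-monoˡ-< ([ inAℕ (suc y) ]· G m (scaled (suc y))) (partialG< y gap)) (telescope-step (inAℕ (suc y)) y))

        ∑A-G<b^m : Σ[ z ∈ ℕ ] z ℕ.< b × inAℕ z ≡ false → ∑A (λ a → G m (scaled a)) < bℚ ^ℚ m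
        ∑A-G<b^m (z , z<b , z∉A) =
          subst₂ _<_ (sym (∑A≡∑[≤f] (λ a → G m (scaled a)))) (cong (_^ℚ m) scaled-f+1≡b) (partialG< f gap)
          where
          scaled-f+1≡b : scaled f + 1ℚ ≡ bℚ
          scaled-f+1≡b = trans (cong (_+ 1ℚ) f*c≡b-1) b-1+1≡b
          gap : Gap f
          gap with ℕₚ.m≤n⇒m<n∨m≡n f≤b-1
          ... | inj₁ f<b-1 = inj₂ (f<b-1⇒1<c f<b-1 , f , 1≤f , ℕₚ.≤-refl , f∈A)
          ... | inj₂ f≡b-1 = inj₁ (z , subst (z ℕ.≤_) (sym f≡b-1) (ℕₚ.<⇒≤pred z<b) , z∉A)

      -- Evaluate y ↦ G m y + (b - 1) m y^(m-1) at the scaled digit f, i.e. at y = b - 1.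
      b^m<∑A-G+[b-1]τ : ∀ M → let m = suc (suc M) in
                         bℚ ^ℚ m < ∑A (λ a → G m (scaled a)) + ℕ→ℚ (b ∸ 1) * τ m (suc M)
      b^m<∑A-G+[b-1]τ M = begin-strict
        bℚ ^ℚ m
          <⟨ subst (_< bℚ ^ℚ m + ℕ→ℚ (suc M) * b₁ ^ℚ m) (ℚₚ.+-identityʳ _)
               (ℚₚ.+-monoʳ-< (bℚ ^ℚ m) (pos*pos⇒pos (ℕ→ℚ-mono-< {0} {suc M} (s≤s z≤n)) (ℚₚ.<-≤-trans 0<1 (1≤^ℚ m 1≤b₁)))) ⟩
        bℚ ^ℚ m + ℕ→ℚ (suc M) * b₁ ^ℚ m
          ≡⟨ sym φ[b-1]≡ ⟩
        φ b₁
          ≤⟨ subst (λ y → φ y ≤ ∑A (λ a → φ (scaled a))) f*c≡b-1 (term≤∑A f∈A (inAℕ-<b f∈A) (λ d → 0≤φ (0≤scaled d))) ⟩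
        ∑A (λ a → φ (scaled a))
          ≡⟨ ∑A-distrib-+ (λ a → G m (scaled a)) (λ a → b₁ * ℕ→ℚ m * scaled a ^ℚ suc M) ⟩
        ∑A (λ a → G m (scaled a)) + ∑A (λ a → b₁ * ℕ→ℚ m * scaled a ^ℚ suc M)
          ≡⟨ cong (∑A (λ a → G m (scaled a)) +_) (sym (*-distribˡ-∑A (b₁ * ℕ→ℚ m) (λ a → scaled a ^ℚ suc M))) ⟩
        ∑A (λ a → G m (scaled a)) + b₁ * ℕ→ℚ m * ∑A (λ a → scaled a ^ℚ suc M)
          ≡⟨ cong (∑A (λ a → G m (scaled a)) +_) (trans (ℚₚ.*-assoc b₁ (ℕ→ℚ m) _) (cong (b₁ *_) (sym τ-m-[m-1]≡))) ⟩
        ∑A (λ a → G m (scaled a)) + b₁ * τ m (suc M)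
          ∎
        where
        open ℚₚ.≤-Reasoning
        m : ℕ
        m = suc (suc M)
        b₁ : ℚ
        b₁ = ℕ→ℚ (b ∸ 1)
        1≤b₁ : 1ℚ ≤ b₁
        1≤b₁ = ℕ→ℚ-mono-≤ {1} {b ∸ 1} (ℕₚ.∸-monoˡ-≤ 1 hb)
        φ : ℚ → ℚ
        φ y = G m y + b₁ * ℕ→ℚ m * y ^ℚ suc M
        0≤φ : ∀ {y} → 0ℚ ≤ y → 0ℚ ≤ φ y
        0≤φ 0≤y = nonNeg+nonNeg⇒nonNeg (0≤G (suc M) _ 0≤y)
          (nonNeg*nonNeg⇒nonNeg (nonNeg*nonNeg⇒nonNeg (ℕ→ℚ-nonNeg (b ∸ 1)) (ℕ→ℚ-nonNeg m)) (^ℚ-nonNeg (suc M) 0≤y))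
        φ[b-1]≡ : φ b₁ ≡ bℚ ^ℚ m + ℕ→ℚ (suc M) * b₁ ^ℚ m
        φ[b-1]≡ = begin-equality
          (b₁ + 1ℚ) ^ℚ m - b₁ ^ℚ m + b₁ * ℕ→ℚ m * b₁ ^ℚ suc M
            ≡⟨ cong₂ (λ x y → x ^ℚ m - b₁ ^ℚ m + b₁ * y * b₁ ^ℚ suc M) b-1+1≡b (ℕ→ℚ-suc (suc M)) ⟩
          bℚ ^ℚ m - b₁ * b₁ ^ℚ suc M + b₁ * (1ℚ + ℕ→ℚ (suc M)) * b₁ ^ℚ suc M
            ≡⟨ solve 4 (λ B b₁ k Q → B :+ (:- (b₁ :* Q)) :+ b₁ :* (con 1ℚ :+ k) :* Q := B :+ k :* (b₁ :* Q)) refl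
                 (bℚ ^ℚ m) b₁ (ℕ→ℚ (suc M)) (b₁ ^ℚ suc M) ⟩
          bℚ ^ℚ m + ℕ→ℚ (suc M) * b₁ ^ℚ m
            ∎
        τ-m-[m-1]≡ : τ m (suc M) ≡ ℕ→ℚ m * ∑A (λ a → scaled a ^ℚ suc M)
        τ-m-[m-1]≡ = cong₂ _*_ (cong ℕ→ℚ mC[m-1]≡m) (γ*c^j≡∑A (suc M))
          where
          mC[m-1]≡m : m C suc M ≡ m
          mC[m-1]≡m = trans (nCk≡nC[n∸k] (ℕₚ.n≤1+n (suc M))) (trans (cong (m C_) (ℕₚ.m+n∸n≡m 1 (suc M))) (nC1≡n m))

      β*[b-1]≡1-β : β * ℕ→ℚ (b ∸ 1) ≡ 1ℚ - β
      β*[b-1]≡1-β = begin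
        β * ℕ→ℚ (b ∸ 1)          ≡⟨ cong (β *_) (ℕ→ℚ-homo-∸ {b} {1} (ℕₚ.<⇒≤ hb)) ⟩
        β * (bℚ - 1ℚ)            ≡⟨ solve 2 (λ β B → β :* (B :+ (:- con 1ℚ)) := β :* B :+ (:- β)) refl β bℚ ⟩
        β * bℚ - β               ≡⟨ cong (_- β) (⁻¹-inverseˡ bℚ≢0) ⟩
        1ℚ - β                   ∎
        where open ≡-Reasoning

      Bounded : ℕ → Set
      Bounded k = β ≤ lam u k × lam u k ≤ 1ℚ

      module _ (M : ℕ) (bounded : ∀ k → 1 ℕ.≤ k → k ℕ.≤ suc M → Bounded k) where

        private
          m : ℕ
          m = suc (suc M)
          D : ℚ
          D = bℚ ^ℚ m - ℕ→ℚ N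
          τ′ : ℕ → ℚ
          τ′ i = τ m (suc i)

          0<D : 0ℚ < D
          0<D = p<q⇒0<q-p (N<bℚ^[1+m] (suc M))

          bounded-at : ∀ i → i ℕ.< suc M → Bounded (suc M ∸ i)
          bounded-at i i<1+M = bounded (suc M ∸ i) (ℕₚ.m<n⇒0<n∸m i<1+M) (ℕₚ.m∸n≤m (suc M) i)

        lam<1 : Σ[ z ∈ ℕ ] z ℕ.< b × inAℕ z ≡ false → lam u m < 1ℚ
        lam<1 nonDigit = *-cancelʳ-<-nonNeg (ℚₚ.<⇒≤ 0<D) (begin-strict
          lam u m * D                                  ≡⟨ ℚₚ.*-comm (lam u m) D ⟩
          D * lam u m                                  ≡⟨ lam-recurrence-τ M ⟩
          ∑ (suc M) (λ i → τ′ i * lam u (suc M ∸ i))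
            ≤⟨ ∑-mono-≤ (suc M) (λ i i<1+M → subst (τ′ i * lam u (suc M ∸ i) ≤_) (ℚₚ.*-identityʳ (τ′ i))
                 (*-monoˡ-≤-nonNeg (τ-nonNeg m (suc i)) (proj₂ (bounded-at i i<1+M)))) ⟩
          ∑ (suc M) τ′                                 ≡⟨ ∑τ-inner (suc M) ⟩
          ∑A (λ a → G m (scaled a)) - ℕ→ℚ N            <⟨ ℚₚ.+-monoˡ-< (- ℕ→ℚ N) (∑A-G<b^m (suc M) nonDigit) ⟩
          D                                            ≡⟨ sym (ℚₚ.*-identityˡ D) ⟩
          1ℚ * D                                       ∎)
          where open ℚₚ.≤-Reasoning

        -- The last term of the recursion has the known factor λ₁ = 1; the others are at least β.
        ∑τ′β+τ′≤D*lam : ∑ M τ′ * β + τ′ M ≤ D * lam u m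
        ∑τ′β+τ′≤D*lam = begin
          ∑ M τ′ * β + τ′ M
            ≡⟨ cong₂ _+_ (*-distribʳ-∑ M β τ′) (sym (trans (cong (τ′ M *_) (trans (cong (lam u) (ℕₚ.m+n∸n≡m 1 M)) lam-1))
                                                          (ℚₚ.*-identityʳ (τ′ M)))) ⟩
          ∑ M (λ i → τ′ i * β) + τ′ M * lam u (suc M ∸ M)
            ≤⟨ ℚₚ.+-monoˡ-≤ _ (∑-mono-≤ M (λ i i<M →
                 *-monoˡ-≤-nonNeg (τ-nonNeg m (suc i)) (proj₁ (bounded-at i (ℕₚ.m<n⇒m<1+n i<M))))) ⟩
          ∑ M (λ i → τ′ i * lam u (suc M ∸ i)) + τ′ M * lam u (suc M ∸ M)
            ≡⟨ sym (∑-init-last M (λ i → τ′ i * lam u (suc M ∸ i))) ⟩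
          ∑ (suc M) (λ i → τ′ i * lam u (suc M ∸ i))
            ≡⟨ sym (lam-recurrence-τ M) ⟩
          D * lam u m
            ∎
          where open ℚₚ.≤-Reasoning

        β<lam : β < lam u m
        β<lam = *-cancelʳ-<-nonNeg (ℚₚ.<⇒≤ 0<D) (begin-strict
          β * D
            ≡⟨ solve 3 (λ β P n → β :* (P :+ (:- n)) := β :* P :+ (:- (β :* n))) refl β (bℚ ^ℚ m) (ℕ→ℚ N) ⟩
          β * bℚ ^ℚ m - β * ℕ→ℚ N
            <⟨ ℚₚ.+-monoˡ-< (- (β * ℕ→ℚ N)) (*-monoʳ-<-pos (⁻¹-pos 0<bℚ) (b^m<∑A-G+[b-1]τ M)) ⟩
          β * (SG + ℕ→ℚ (b ∸ 1) * τ′ M) - β * ℕ→ℚ N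
            ≡⟨ solve 5 (λ β s q t n → β :* (s :+ q :* t) :+ (:- (β :* n)) := β :* (s :+ (:- n)) :+ (β :* q) :* t) refl
                 β SG (ℕ→ℚ (b ∸ 1)) (τ′ M) (ℕ→ℚ N) ⟩
          β * (SG - ℕ→ℚ N) + β * ℕ→ℚ (b ∸ 1) * τ′ M
            ≡⟨ cong₂ (λ x y → β * x + y * τ′ M) (sym (∑τ-inner (suc M))) β*[b-1]≡1-β ⟩
          β * ∑ (suc M) τ′ + (1ℚ - β) * τ′ M
            ≡⟨ cong (λ t → β * t + (1ℚ - β) * τ′ M) (∑-init-last M τ′) ⟩
          β * (∑ M τ′ + τ′ M) + (1ℚ - β) * τ′ M
            ≡⟨ solve 3 (λ β s t → β :* (s :+ t) :+ (con 1ℚ :+ (:- β)) :* t := s :* β :+ t) refl β (∑ M τ′) (τ′ M) ⟩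
          ∑ M τ′ * β + τ′ M
            ≤⟨ ∑τ′β+τ′≤D*lam ⟩
          D * lam u m
            ≡⟨ ℚₚ.*-comm D (lam u m) ⟩
          lam u m * D
            ∎)
          where
          open ℚₚ.≤-Reasoning
          SG : ℚ
          SG = ∑A (λ a → G m (scaled a))

      lam-bounds : Σ[ z ∈ ℕ ] z ℕ.< b × inAℕ z ≡ false → ∀ m → 2 ℕ.≤ m → β < lam u m × lam u m < 1ℚ
      lam-bounds nonDigit (suc zero) (s≤s ())
      lam-bounds nonDigit (suc (suc M)) _ = β<lam M bounded , lam<1 M bounded nonDigit
        where
        P : ℕ → Set
        P k = 1 ℕ.≤ k → Bounded k
        step : ∀ k → (∀ {j} → j ℕ.< k → P j) → P k
        step (suc zero) _ _ = subst (β ≤_) (sym lam-1) β≤1 , ℚₚ.≤-reflexive lam-1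
        step (suc (suc k)) ih _ = ℚₚ.<⇒≤ (β<lam k bounded-below) , ℚₚ.<⇒≤ (lam<1 k bounded-below nonDigit)
          where
          bounded-below : ∀ j → 1 ℕ.≤ j → j ℕ.≤ suc k → Bounded j
          bounded-below j 1≤j j≤1+k = ih (s≤s j≤1+k) 1≤j
        bounded : ∀ k → 1 ℕ.≤ k → k ℕ.≤ suc M → Bounded k
        bounded k 1≤k _ = <-rec P step k 1≤k

proposition3 : (b : ℕ) (hb : 1 ℕ.< b) (A : Subset b) →
    A ≢ ⊤ → A ≢ ⁅ zeroFin hb ⁆ → Nonempty A →
    let open Base b hb A in
    Σ (ℕ → ℚ) (λ u →
    (∀ m → ConvergesTo (uPartial m) (u m))
    × (∀ m → 2 ℕ.≤ m → (ℕ→ℚ (b ℕ.^ m) - ℕ→ℚ N) * lam u m ≡ rhs u m)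
    × (∀ m → 2 ℕ.≤ m → (1ℚ ÷₀ bℚ) Data.Rational.< lam u m × lam u m Data.Rational.< 1ℚ)
    × lam u 1 ≡ 1ℚ)
proposition3 b hb A A≢⊤ A≢⁅0⁆ A≢∅ =
  u , u-converges N<b′ , recurrence , lam-bounds N<b′ 1≤f (∃nonDigit A≢⊤) , lam-1 N<b′
  where
  open Base b hb A
  open DigitSet b hb A
  N<b′ : N ℕ.< b
  N<b′ = N<b A≢⊤
  1≤f : 1 ℕ.≤ f
  1≤f = let (a , 1≤a , a∈A) = ∃nonzeroDigit A≢⁅0⁆ A≢∅ in ℕₚ.≤-trans 1≤a (digit≤f a∈A)
  recurrence : ∀ m → 2 ℕ.≤ m → (ℕ→ℚ (b ℕ.^ m) - ℕ→ℚ N) * lam u m ≡ rhs u m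
  recurrence (suc zero) (s≤s ())
  recurrence (suc (suc M)) _ = lam-recurrence N<b′ 1≤f M
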